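{- Let $\alpha=(\alpha_1,\dots,\alpha_\ell)$ be a strong composition. (1) If there exist $i<j<k$ with $\alpha_i<\alpha_j<\alpha_k$, then $\kappa_\alpha$ is not multiplicity free. (2) If there exist $i<j<k<l$ with $\alpha_i<\alpha_l$, $\alpha_j<\alpha_l$ and $\alpha_l<\alpha_k$, then $\kappa_\alpha$ is not multiplicity free. (3) If there exist $i<j<k<l$ with $\alpha_i<\alpha_k$, $\alpha_j+1<\alpha_k$ and $\alpha_k=\alpha_l$, then $\kappa_\alpha$ is not multiplicity free.
   Context: A weak composition $a=(a_1,\dots,a_\ell)$ of length $\ell$ is a finite sequence of nonnegative integers; a strong composition is one whose parts are all positive. A diagram is a finite set of cells $(r,c)$ with $r,c$ positive integers, the cell $(r,c)$ lying in row $r$ (counted from the bottom) and column $c$ (counted from the left). A Kohnert tableau of content $a$ is a diagram whose cells are filled with positive integers, with exactly $a_i$ cells containing $i$ for each $i$, such that: (i) for each $i$ there is exactly one $i$ in each of the columns $1,\dots,a_i$; (ii) every entry in row $r$ is at least $r$; (iii) for each $i$, the cells containing $i$ weakly descend from left to right; (iv) if $i<j$ appear in the same column with $i$ above $j$, then there is an $i$ in the column immediately to the right of the cell containing that $j$, in a row strictly above it. It is quasi-Yamanouchi if moreover (v) for each nonempty row $r$, either row $r$ contains an entry equal to $r$, or some cell of row $r+1$ lies weakly to the right of some cell of row $r$. Let $\mathrm{QKT}(a)$ be the set of quasi-Yamanouchi Kohnert tableaux of content $a$, and $\mathrm{wt}(T)$ the weak composition of length $\ell$ whose $r$-th part is the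 number of cells in row $r$ of $T$. The key polynomial $\kappa_a$ (the sum of $x^{\mathrm{wt}(T)}$ over all Kohnert tableaux $T$ of content $a$) satisfies $\kappa_a=\sum_{T\in\mathrm{QKT}(a)}\mathfrak{F}_{\mathrm{wt}(T)}$, where $\mathfrak{F}_b$ denotes the fundamental slide polynomial. We say $\kappa_a$ is multiplicity free if distinct tableaux in $\mathrm{QKT}(a)$ have distinct weights. -}

module Defs where

open import Data.Nat using (ℕ; zero; suc; _≤_; _<_; _≟_)
open import Data.Fin using (Fin; toℕ)
open import Data.List using (List; length; lookup; map; filter; allFin)
open import Data.Nat.ListAction using (sum)
open import Data.List.Relation.Unary.All using (All)
open import Data.Vec using (Vec; tabulate)
open import Data.Product using (Σ; Σ-syntax; _×_)
open import Data.Sum using (_⊎_)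
open import Relation.Binary.PropositionalEquality using (_≡_)
open import Relation.Nullary using (¬_)

StrongComposition : List ℕ → Set
StrongComposition α = All (λ x → 0 < x) α

-- Entries are 1..ℓ, represented by i : Fin ℓ with entry value suc (toℕ i).
-- Columns of entry i are 1..a_i, represented by c : Fin (a_i) with column suc (toℕ c).
-- A filled diagram of content a in which, for each i, there is exactly one i in
-- each column 1..a_i (and no other i) is determined by the row of the i in column c.
-- Rows are counted from 1.
Filling : List ℕ → Set
Filling a = (i : Fin (length a)) → Fin (lookup a i) → ℕ

DistinctCells : (a : List ℕ) → Filling a → Set
DistinctCells a row = ∀ (i j : Fin (length a)) (c : Fin (lookup a i)) (d : Fin (lookup a j)) →
  toℕ c ≡ toℕ d → row i c ≡ row j d → i ≡ j

record KohnertTableau (a : List ℕ) : Set where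
  field
    row : Filling a
    distinct : DistinctCells a row
    rowPos : ∀ i c → 1 ≤ row i c
    entry≥row : ∀ i c → row i c ≤ suc (toℕ i)
    descend : ∀ i (c d : Fin (lookup a i)) → toℕ c < toℕ d → row i d ≤ row i c
    colCond : ∀ (i j : Fin (length a)) (c : Fin (lookup a i)) (d : Fin (lookup a j)) →
      toℕ i < toℕ j → toℕ c ≡ toℕ d → row j d < row i c →
      Σ[ e ∈ Fin (lookup a i) ] (toℕ e ≡ suc (toℕ d) × row j d < row i e)

open KohnertTableau public

QuasiYamanouchi : {a : List ℕ} → KohnertTableau a → Set
QuasiYamanouchi {a} T = ∀ (r : ℕ) →
  (Σ[ i ∈ Fin (length a) ] Σ[ c ∈ Fin (lookup a i) ] row T i c ≡ r) →
  (Σ[ i ∈ Fin (length a) ] Σ[ c ∈ Fin (lookup a i) ] (row T i c ≡ r × suc (toℕ i) ≡ r))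
  ⊎ (Σ[ i ∈ Fin (length a) ] Σ[ c ∈ Fin (lookup a i) ]
     Σ[ j ∈ Fin (length a) ] Σ[ d ∈ Fin (lookup a j) ]
       (row T i c ≡ r × row T j d ≡ suc r × toℕ c ≤ toℕ d))

rowCount : {a : List ℕ} → KohnertTableau a → ℕ → ℕ
rowCount {a} T r =
  sum (map (λ i → length (filter (λ c → row T i c ≟ r) (allFin (lookup a i))))
           (allFin (length a)))

wt : {a : List ℕ} → KohnertTableau a → Vec ℕ (length a)
wt T = tabulate (λ r → rowCount T (suc (toℕ r)))

-- κ_a is multiplicity free: distinct tableaux in QKT(a) have distinct weights,
-- i.e. two QKT of equal weight are the same tableau (same filled cells).
MultiplicityFree : List ℕ → Set
MultiplicityFree a = ∀ (T U : KohnertTableau a) → QuasiYamanouchi T → QuasiYamanouchi U →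
  wt T ≡ wt U → ∀ i c → row T i c ≡ row U i c

module Submission where

-- Each pattern yields two distinct quasi-Yamanouchi Kohnert tableaux of the same weight.
-- Both arise from the key tableau, in which entry p fills the first α_p cells of row p,
-- by sliding cells down along chains: for a base b, a column x and a chain of entries
-- b < p₁ < … < p_m = top, each p_s moves its cell in column x into the row of p_(s-1),
-- and p₁ into row b.  A chain takes one cell from row top and gives one
-- to row b, so the weight only depends on the tops and bases, while the two tableaux differ in
-- which entries move.  Column 1 never moves, so every nonempty row r contains the entry r.
-- The inequalities of each pattern are what lets two differently arranged pairs of chains
-- keep the Kohnert conditions; in case (2) with α_k = α_l + 1 the argument needs that α has
-- no increasing triple, and otherwise case (1) applies.

open import Defs
open import Data.Bool using (false; true; if_then_else_)
open import Data.Empty using (⊥; ⊥-elim)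
open import Data.Fin using (Fin; toℕ; fromℕ<) renaming (zero to fzero; suc to fsuc)
open import Data.Fin.Properties using (toℕ-injective; toℕ<n; toℕ-fromℕ<)
open import Data.List using (List; []; _∷_; length; lookup; map; filter; allFin; tabulate)
open import Data.List.Relation.Unary.All using (_∷_)
open import Data.Nat using (ℕ; zero; suc; _+_; _<_; _≤_; _≟_; _<?_; _≤?_; z≤n; s≤s; pred; >-nonZero)
open import Data.Nat.ListAction using (sum)
open import Data.Nat.Properties
open import Data.Nat.Tactic.RingSolver using (solve-∀)
open import Data.Product using (Σ; Σ-syntax; _×_; _,_; proj₁; proj₂)
open import Data.Sum using (_⊎_; inj₁; inj₂)
open import Data.Vec.Properties using (tabulate-cong)
open import Function using (_∘_)
open import Relation.Binary.Definitions using (tri<; tri≈; tri>)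
open import Relation.Binary.PropositionalEquality
open import Relation.Nullary using (Dec; yes; no; does; ¬_; _×-dec_; _⊎-dec_)
open import Relation.Unary using (Pred; Decidable; ∅; _∪_)
open import Relation.Unary.Properties using (∅?; _∪?_)

-- Finite sums and indicators

sum< : ℕ → (ℕ → ℕ) → ℕ
sum< zero    f = 0
sum< (suc n) f = f 0 + sum< n (f ∘ suc)

sum<-cong : ∀ n {f g : ℕ → ℕ} → (∀ p → p < n → f p ≡ g p) → sum< n f ≡ sum< n g
sum<-cong zero    eq = refl
sum<-cong (suc n) eq = cong₂ _+_ (eq 0 (s≤s z≤n)) (sum<-cong n (λ p p<n → eq (suc p) (s≤s p<n)))

sum<-zero : ∀ n {f : ℕ → ℕ} → (∀ p → p < n → f p ≡ 0) → sum< n f ≡ 0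
sum<-zero n eq = trans (sum<-cong n eq) (sum<-const-zero n)
  where
  sum<-const-zero : ∀ n → sum< n (λ _ → 0) ≡ 0
  sum<-const-zero zero    = refl
  sum<-const-zero (suc n) = sum<-const-zero n

sum<-single : ∀ n {f : ℕ → ℕ} m → m < n → f m ≡ 1 → (∀ p → p < n → p ≢ m → f p ≡ 0) → sum< n f ≡ 1
sum<-single (suc n) zero    _         f0≡1 others rewrite f0≡1 =
  cong suc (sum<-zero n (λ p p<n → others (suc p) (s≤s p<n) (λ ())))
sum<-single (suc n) (suc m) (s≤s m<n) fm≡1 others rewrite others 0 (s≤s z≤n) (λ ()) =
  sum<-single n m m<n fm≡1 (λ p p<n p≢m → others (suc p) (s≤s p<n) (p≢m ∘ suc-injective))

sum<-+ : ∀ n (f g : ℕ → ℕ) → sum< n (λ p → f p + g p) ≡ sum< n f + sum< n g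
sum<-+ zero    f g = refl
sum<-+ (suc n) f g rewrite sum<-+ n (f ∘ suc) (g ∘ suc) =
  interchange (f 0) (g 0) (sum< n (f ∘ suc)) (sum< n (g ∘ suc))
  where
  interchange : ∀ a b c d → a + b + (c + d) ≡ a + c + (b + d)
  interchange = solve-∀

sum<-update : ∀ n (f g : ℕ → ℕ) x → x < n → (∀ c → c < n → c ≢ x → g c ≡ f c) →
  sum< n g + f x ≡ sum< n f + g x
sum<-update (suc n) f g zero    _         agree
  rewrite sum<-cong n (λ p p<n → agree (suc p) (s≤s p<n) (λ ())) = rotate (g 0) (sum< n (f ∘ suc)) (f 0)
  where
  rotate : ∀ u v w → u + v + w ≡ w + v + u
  rotate = solve-∀
sum<-update (suc n) f g (suc x) (s≤s x<n) agree
  rewrite agree 0 (s≤s z≤n) (λ ()) | +-assoc (f 0) (sum< n (g ∘ suc)) (f (suc x))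
        | +-assoc (f 0) (sum< n (f ∘ suc)) (g (suc x)) =
  cong (f 0 +_) (sum<-update n (f ∘ suc) (g ∘ suc) x x<n
                   (λ p p<n p≢x → agree (suc p) (s≤s p<n) (p≢x ∘ suc-injective)))

sumFin : (n : ℕ) → (Fin n → ℕ) → ℕ
sumFin zero    f = 0
sumFin (suc n) f = f fzero + sumFin n (f ∘ fsuc)

sumFin-cong : ∀ n {f g : Fin n → ℕ} → (∀ k → f k ≡ g k) → sumFin n f ≡ sumFin n g
sumFin-cong zero    eq = refl
sumFin-cong (suc n) eq = cong₂ _+_ (eq fzero) (sumFin-cong n (eq ∘ fsuc))

sumFin-toℕ : ∀ n (g : ℕ → ℕ) → sumFin n (g ∘ toℕ) ≡ sum< n g
sumFin-toℕ zero    g = refl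
sumFin-toℕ (suc n) g = cong (g 0 +_) (sumFin-toℕ n (g ∘ suc))

𝟙 : ∀ {p} {A : Set p} → Dec A → ℕ
𝟙 d = if does d then 1 else 0

𝟙-yes : ∀ {p} {A : Set p} (d : Dec A) → A → 𝟙 d ≡ 1
𝟙-yes (yes _) _ = refl
𝟙-yes (no ¬a) a = ⊥-elim (¬a a)

𝟙-no : ∀ {p} {A : Set p} (d : Dec A) → ¬ A → 𝟙 d ≡ 0
𝟙-no (yes a) ¬a = ⊥-elim (¬a a)
𝟙-no (no _)  _  = refl

𝟙-×-yes : ∀ {p q} {A : Set p} {B : Set q} (d : Dec A) (e : Dec B) → A → 𝟙 (d ×-dec e) ≡ 𝟙 e
𝟙-×-yes (yes _) (yes _) _ = refl
𝟙-×-yes (yes _) (no _)  _ = refl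
𝟙-×-yes (no ¬a) e       a = ⊥-elim (¬a a)

𝟙-×-no : ∀ {p q} {A : Set p} {B : Set q} (d : Dec A) (e : Dec B) → ¬ A → 𝟙 (d ×-dec e) ≡ 0
𝟙-×-no (yes a) e ¬a = ⊥-elim (¬a a)
𝟙-×-no (no _)  e _  = refl

-- Unlike `if does d then … else …`, this is stuck on d itself, so `with d` abstracts it in goals.
if?_then_else_ : ∀ {p} {A : Set p} → Dec A → ℕ → ℕ → ℕ
if? yes _ then x else _ = x
if? no _  then _ else y = y

if?-yes : ∀ {p} {A : Set p} (d : Dec A) {x y : ℕ} → A → (if? d then x else y) ≡ x
if?-yes (yes _) _ = refl
if?-yes (no ¬a) a = ⊥-elim (¬a a)

if?-no : ∀ {p} {A : Set p} (d : Dec A) {x y : ℕ} → ¬ A → (if? d then x else y) ≡ y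
if?-no (yes a) ¬a = ⊥-elim (¬a a)
if?-no (no _)  _  = refl

length-filter-tabulate : ∀ {a p} {A : Set a} {P : Pred A p} {n} (h : Fin n → A) (P? : Decidable P) →
  length (filter P? (tabulate h)) ≡ sumFin n (λ k → 𝟙 (P? (h k)))
length-filter-tabulate {n = zero}  h P? = refl
length-filter-tabulate {n = suc n} h P? with does (P? (h fzero))
... | false = length-filter-tabulate (h ∘ fsuc) P?
... | true  = cong suc (length-filter-tabulate (h ∘ fsuc) P?)

sum-map-tabulate : ∀ {a} {A : Set a} {n} (h : Fin n → A) (G : A → ℕ) →
  sum (map G (tabulate h)) ≡ sumFin n (G ∘ h)
sum-map-tabulate {n = zero}  h G = refl
sum-map-tabulate {n = suc n} h G = cong (G (h fzero) +_) (sum-map-tabulate (h ∘ fsuc) G)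

module _ {q} {Q : ℕ → Set q} (Q? : Decidable Q) where

  leastWitness : ∀ n → Σ ℕ (λ m → m ≤ n × Q m) → Σ ℕ λ m → m ≤ n × Q m × (∀ x → x < m → ¬ Q x)
  leastWitness zero    (m , m≤0 , qm) = m , m≤0 , qm , λ x x<m _ → n≮0 (<-≤-trans x<m m≤0)
  leastWitness (suc n) (m , m≤1+n , qm) with anyUpTo? Q? (suc n)
  ... | yes (m′ , s≤s m′≤n , qm′) =
    let (k , k≤n , qk , least) = leastWitness n (m′ , m′≤n , qm′) in k , m≤n⇒m≤1+n k≤n , qk , least
  ... | no none = m , m≤1+n , qm , λ x x<m qx → none (x , <-≤-trans x<m m≤1+n , qx)

-- Chains

module Chain (b : ℕ) {q} (P : ℕ → Set q) (P? : Decidable P) (top : ℕ) where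

  Member : ℕ → Set q
  Member p = b < p × p ≤ top × P p

  member? : Decidable Member
  member? p = (b <? p) ×-dec ((p ≤? top) ×-dec P? p)

  Node : ℕ → Set q
  Node p = p ≡ b ⊎ Member p

  greatestAtMost : ℕ → ℕ
  greatestAtMost zero = b
  greatestAtMost (suc x) with suc x ≤? b
  ... | yes _ = b
  ... | no _ with P? (suc x)
  ...   | yes _ = suc x
  ...   | no _  = greatestAtMost x

  base≤greatestAtMost : ∀ x → b ≤ greatestAtMost x
  base≤greatestAtMost zero = ≤-refl
  base≤greatestAtMost (suc x) with suc x ≤? b
  ... | yes _ = ≤-refl
  ... | no 1+x≰b with P? (suc x)
  ...   | yes _ = <⇒≤ (≰⇒> 1+x≰b)
  ...   | no _  = base≤greatestAtMost x

  greatestAtMost≤ : ∀ x → b ≤ x → greatestAtMost x ≤ x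
  greatestAtMost≤ zero b≤x = b≤x
  greatestAtMost≤ (suc x) b≤1+x with suc x ≤? b
  ... | yes _ = b≤1+x
  ... | no 1+x≰b with P? (suc x)
  ...   | yes _ = ≤-refl
  ...   | no _  = m≤n⇒m≤1+n (greatestAtMost≤ x (≤-pred (≰⇒> 1+x≰b)))

  greatestAtMost-spec : ∀ x → greatestAtMost x ≡ b ⊎ (b < greatestAtMost x × P (greatestAtMost x))
  greatestAtMost-spec zero = inj₁ refl
  greatestAtMost-spec (suc x) with suc x ≤? b
  ... | yes _ = inj₁ refl
  ... | no 1+x≰b with P? (suc x)
  ...   | yes p = inj₂ (≰⇒> 1+x≰b , p)
  ...   | no _  = greatestAtMost-spec x

  greatestAtMost-maximal : ∀ x y → b < y → y ≤ x → P y → y ≤ greatestAtMost x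
  greatestAtMost-maximal zero y b<y y≤0 _ = ⊥-elim (n≮0 (<-≤-trans b<y y≤0))
  greatestAtMost-maximal (suc x) y b<y y≤1+x py with suc x ≤? b
  ... | yes 1+x≤b = ⊥-elim (<-irrefl refl (<-≤-trans b<y (≤-trans y≤1+x 1+x≤b)))
  ... | no _ with P? (suc x)
  ...   | yes _ = y≤1+x
  ...   | no ¬p with m≤n⇒m<n∨m≡n y≤1+x
  ...     | inj₁ y<1+x = greatestAtMost-maximal x y b<y (≤-pred y<1+x) py
  ...     | inj₂ refl  = ⊥-elim (¬p py)

  prev : ℕ → ℕ
  prev p = greatestAtMost (pred p)

  base≤prev : ∀ p → b ≤ prev p
  base≤prev p = base≤greatestAtMost (pred p)

  prev< : ∀ p → b < p → prev p < p
  prev< (suc p) (s≤s b≤p) = s≤s (greatestAtMost≤ p b≤p)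

  prev-maximal : ∀ p y → b < y → y < p → P y → y ≤ prev p
  prev-maximal (suc p) y b<y (s≤s y≤p) py = greatestAtMost-maximal p y b<y y≤p py

  prev-spec : ∀ p → prev p ≡ b ⊎ (b < prev p × P (prev p))
  prev-spec p = greatestAtMost-spec (pred p)

  prev-node : ∀ {p} → Member p → Node (prev p)
  prev-node {p} (b<p , p≤top , _) with prev-spec p
  ... | inj₁ e = inj₁ e
  ... | inj₂ (b<prev , P-prev) = inj₂ (b<prev , ≤-trans (<⇒≤ (prev< p b<p)) p≤top , P-prev)

  base≤node : ∀ {p} → Node p → b ≤ p
  base≤node (inj₁ refl)      = ≤-refl
  base≤node (inj₂ (b<p , _)) = <⇒≤ b<p

  member≤prev : ∀ {m} n → Member m → m < n → m ≤ prev n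
  member≤prev {m} n (b<m , _ , pm) m<n = prev-maximal n m b<m m<n pm

  node≤prev : ∀ {m} n → Node m → m < n → m ≤ prev n
  node≤prev n (inj₁ refl) _   = base≤prev n
  node≤prev n (inj₂ mm)   m<n = member≤prev n mm m<n

  prev-injective : ∀ {p q} → Member p → Member q → prev p ≡ prev q → p ≡ q
  prev-injective {p} {q} mp mq e with <-cmp p q
  ... | tri< p<q _ _ = ⊥-elim (<-irrefl e (<-≤-trans (prev< p (proj₁ mp)) (member≤prev q mp p<q)))
  ... | tri≈ _ p≡q _ = p≡q
  ... | tri> _ _ q<p = ⊥-elim (<-irrefl (sym e) (<-≤-trans (prev< q (proj₁ mq)) (member≤prev p mq q<p)))

  prev<-gap : ∀ n lo → b < lo → b < n → (∀ m → lo ≤ m → m < n → ¬ P m) → prev n < lo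
  prev<-gap n lo b<lo b<n gap with prev-spec n
  ... | inj₁ e = subst (_< lo) (sym e) b<lo
  ... | inj₂ (_ , P-prev) with lo ≤? prev n
  ...   | yes lo≤prev = ⊥-elim (gap (prev n) lo≤prev (prev< n b<n) P-prev)
  ...   | no lo≰prev  = ≰⇒> lo≰prev

  prev≡-gap : ∀ n lo → Node lo → lo < n → (∀ m → lo < m → m < n → ¬ P m) → prev n ≡ lo
  prev≡-gap n lo node-lo lo<n gap = ≤-antisym prev≤lo (node≤prev n node-lo lo<n)
    where
    prev≤lo : prev n ≤ lo
    prev≤lo with prev-spec n
    ... | inj₁ e = subst (_≤ lo) (sym e) (base≤node node-lo)
    ... | inj₂ (_ , P-prev) with lo <? prev n
    ...   | yes lo<prev = ⊥-elim (gap (prev n) lo<prev (prev< n (≤-<-trans (base≤node node-lo) lo<n)) P-prev)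
    ...   | no lo≮prev  = ≮⇒≥ lo≮prev

  fibre : ℕ → ℕ → ℕ
  fibre ℓ r = sum< ℓ (λ p → 𝟙 (member? p ×-dec (prev p ≟ r)))

  fibre-empty : ∀ ℓ r → (∀ p → Member p → prev p ≢ r) → fibre ℓ r ≡ 0
  fibre-empty ℓ r none =
    sum<-zero ℓ (λ p _ → 𝟙-no (member? p ×-dec (prev p ≟ r)) (λ (mp , e) → none p mp e))

  fibre-single : ∀ ℓ r → top < ℓ → Member top → Node r → r < top → fibre ℓ r ≡ 1
  fibre-single ℓ r top<ℓ m-top node-r r<top
    with leastWitness (λ x → (r <? x) ×-dec member? x) top (top , ≤-refl , r<top , m-top)
  ... | s , s≤top , (r<s , m-s) , least =
    sum<-single ℓ s (≤-<-trans s≤top top<ℓ) (𝟙-yes (member? s ×-dec (prev s ≟ r)) (m-s , prev-s≡r))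
      (λ p _ p≢s → 𝟙-no (member? p ×-dec (prev p ≟ r))
                         (λ (mp , e) → p≢s (prev-injective mp m-s (trans e (sym prev-s≡r)))))
    where
    prev-s≤r : prev s ≤ r
    prev-s≤r with prev-node m-s
    ... | inj₁ e = subst (_≤ r) (sym e) (base≤node node-r)
    ... | inj₂ m-prev with r <? prev s
    ...   | yes r<prev = ⊥-elim (least (prev s) (prev< s (proj₁ m-s)) (r<prev , m-prev))
    ...   | no r≮prev  = ≮⇒≥ r≮prev

    prev-s≡r : prev s ≡ r
    prev-s≡r = ≤-antisym prev-s≤r (node≤prev s node-r r<s)

  𝟙-node : ∀ {r} → Node r → 𝟙 (r ≟ b) + 𝟙 (member? r) ≡ 1
  𝟙-node {r} (inj₁ r≡b)
    rewrite 𝟙-yes (r ≟ b) r≡b | 𝟙-no (member? r) (λ (b<r , _) → <-irrefl (sym r≡b) b<r) = refl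
  𝟙-node {r} (inj₂ mr)
    rewrite 𝟙-no (r ≟ b) (λ r≡b → <-irrefl (sym r≡b) (proj₁ mr)) | 𝟙-yes (member? r) mr = refl

  𝟙-¬node : ∀ {r} → ¬ Node r → 𝟙 (r ≟ b) + 𝟙 (member? r) ≡ 0
  𝟙-¬node {r} ¬node rewrite 𝟙-no (r ≟ b) (¬node ∘ inj₁) | 𝟙-no (member? r) (¬node ∘ inj₂) = refl

  node<top : ∀ {r} → Node top → Node r → r ≢ top → r < top
  node<top node-top (inj₁ refl)            r≢top = ≤∧≢⇒< (base≤node node-top) r≢top
  node<top _        (inj₂ (_ , r≤top , _)) r≢top = ≤∧≢⇒< r≤top r≢top

  top-member : ∀ {r} → Node top → b ≤ r → r < top → Member top
  top-member (inj₁ top≡b) b≤r r<top = ⊥-elim (<-irrefl (sym top≡b) (≤-<-trans b≤r r<top))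
  top-member (inj₂ m)     _   _     = m

  fibre-count : ∀ ℓ r → top < ℓ → Node top → fibre ℓ r + 𝟙 (r ≟ top) ≡ 𝟙 (r ≟ b) + 𝟙 (member? r)
  fibre-count ℓ r top<ℓ node-top = by-cases (r ≟ top) ((r ≟ b) ⊎-dec member? r)
    where
    by-cases : Dec (r ≡ top) → Dec (Node r) → fibre ℓ r + 𝟙 (r ≟ top) ≡ 𝟙 (r ≟ b) + 𝟙 (member? r)
    by-cases (yes refl) _ rewrite 𝟙-yes (r ≟ r) refl =
      trans (cong (_+ 1) (fibre-empty ℓ r (λ p (b<p , p≤top , _) e → <-irrefl e (<-≤-trans (prev< p b<p) p≤top))))
            (sym (𝟙-node node-top))
    by-cases (no r≢top) (yes node-r) rewrite 𝟙-no (r ≟ top) r≢top =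
      trans (+-identityʳ _) (trans (fibre-single ℓ r top<ℓ (top-member node-top (base≤node node-r) r<top) node-r r<top)
                                   (sym (𝟙-node node-r)))
      where
      r<top : r < top
      r<top = node<top node-top node-r r≢top
    by-cases (no r≢top) (no ¬node-r) rewrite 𝟙-no (r ≟ top) r≢top =
      trans (+-identityʳ _)
            (trans (fibre-empty ℓ r (λ p mp e → ¬node-r (subst Node e (prev-node mp)))) (sym (𝟙-¬node ¬node-r)))

  fibre-diagonal : ∀ ℓ r → top < ℓ → sum< ℓ (λ p → 𝟙 (member? p ×-dec (p ≟ r))) ≡ 𝟙 (member? r)
  fibre-diagonal ℓ r top<ℓ = by-cases (member? r)
    where
    by-cases : Dec (Member r) → sum< ℓ (λ p → 𝟙 (member? p ×-dec (p ≟ r))) ≡ 𝟙 (member? r)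
    by-cases (yes mr) =
      trans (sum<-single ℓ r (≤-<-trans (proj₁ (proj₂ mr)) top<ℓ) (𝟙-yes (member? r ×-dec (r ≟ r)) (mr , refl))
                         (λ p _ p≢r → 𝟙-no (member? p ×-dec (p ≟ r)) (λ (_ , e) → p≢r e)))
            (sym (𝟙-yes (member? r) mr))
    by-cases (no ¬mr) =
      trans (sum<-zero ℓ (λ p _ → 𝟙-no (member? p ×-dec (p ≟ r)) (λ { (mp , refl) → ¬mr mp })))
            (sym (𝟙-no (member? r) ¬mr))

module ChainSide (a : ℕ → ℕ) (rowOf : ℕ → ℕ → ℕ)
  (b : ℕ) (P : ℕ → Set) (P? : Decidable P) (top x : ℕ)
  (b′ : ℕ) (P′ : ℕ → Set) (P′? : Decidable P′) (top′ x′ : ℕ)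
  where

  module C  = Chain b  P  P?  top
  module C′ = Chain b′ P′ P′? top′

  module Properties
    (rowOf-member  : ∀ p c → C.Member p → c ≡ x → rowOf p c ≡ C.prev p)
    (rowOf-member′ : ∀ p c → C′.Member p → c ≡ x′ → rowOf p c ≡ C′.prev p)
    (rowOf-unmoved : ∀ p c → ¬ (C.Member p × c ≡ x) → ¬ (C′.Member p × c ≡ x′) → rowOf p c ≡ p)
    (base-short    : ∀ p → C.Member p → a b ≤ x)
    (lastColumn    : ∀ n m → C.Member n → C.prev n < m → m < n → a m ≡ suc x → P m ⊎ (C′.Member m × x′ ≡ x))
    (adjacent      : ∀ n m → C.Member n → C′.Member m → x′ ≡ suc x → m < n → C.prev n < m → ¬ C.Member m →
                       C.prev n < C′.prev m)
    (cross         : ∀ n m → C.Member n → C′.Member m → x′ ≡ x → m < n → C′.prev m ≤ C.prev n)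
    (cross-distinct : ∀ p q → C.Member p → C′.Member q → x′ ≡ x → C.prev p ≢ C′.prev q)
    where

    columnCondition : ∀ m n → C.Member n → m < n → x < a m → rowOf n x < rowOf m x →
      suc x < a m × rowOf n x < rowOf m (suc x)
    columnCondition m n mn m<n x<am lt rewrite rowOf-member n x mn refl with C.member? m | C′.member? m ×-dec (x ≟ x′)
    ... | yes mm | _ rewrite rowOf-member m x mm refl =
      ⊥-elim (<-irrefl refl (<-≤-trans (<-trans lt (C.prev< m (proj₁ mm))) (C.member≤prev n mm m<n)))
    ... | no _ | yes (mm′ , e) rewrite rowOf-member′ m x mm′ e =
      ⊥-elim (<-irrefl refl (<-≤-trans lt (cross n m mn mm′ (sym e) m<n)))
    ... | no ¬mm | no ¬mm′ = next-column (m≤n⇒m<n∨m≡n x<am)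
      where
      prev<m : C.prev n < m
      prev<m = subst (C.prev n <_) (rowOf-unmoved m x (¬mm ∘ proj₁) ¬mm′) lt

      next-column : suc x < a m ⊎ suc x ≡ a m → suc x < a m × C.prev n < rowOf m (suc x)
      next-column (inj₂ e) with lastColumn n m mn prev<m m<n (sym e)
      ... | inj₁ pm = ⊥-elim (<-irrefl refl (<-≤-trans prev<m (C.member≤prev n
                        (≤-<-trans (C.base≤prev n) prev<m , ≤-trans (<⇒≤ m<n) (proj₁ (proj₂ mn)) , pm) m<n)))
      ... | inj₂ (mm′ , e′) = ⊥-elim (¬mm′ (mm′ , sym e′))
      next-column (inj₁ 1+x<am) with C′.member? m ×-dec (suc x ≟ x′)
      ... | yes (mm′ , e) rewrite rowOf-member′ m (suc x) mm′ e = 1+x<am , adjacent n m mn mm′ (sym e) m<n prev<m ¬mm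
      ... | no ¬mm′₂ rewrite rowOf-unmoved m (suc x) (λ (_ , e) → <-irrefl (sym e) (n<1+n x)) ¬mm′₂ = 1+x<am , prev<m

    prev-unique : ∀ p q → C.Member p → x < a q → rowOf q x ≡ C.prev p → p ≡ q
    prev-unique p q mp x<aq eq with C.member? q | C′.member? q ×-dec (x ≟ x′)
    ... | yes mq | _ rewrite rowOf-member q x mq refl = C.prev-injective mp mq (sym eq)
    ... | no _ | yes (mq′ , e) rewrite rowOf-member′ q x mq′ e = ⊥-elim (cross-distinct p q mp mq′ (sym e) (sym eq))
    ... | no ¬mq | no ¬mq′ = unmoved (C.prev-node mp)
      where
      q≡prev : q ≡ C.prev p
      q≡prev = trans (sym (rowOf-unmoved q x (¬mq ∘ proj₁) ¬mq′)) eq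

      unmoved : C.Node (C.prev p) → p ≡ q
      unmoved (inj₁ e) =
        ⊥-elim (<-irrefl refl (<-≤-trans x<aq (subst (λ z → a z ≤ x) (sym (trans q≡prev e)) (base-short p mp))))
      unmoved (inj₂ m-prev) = ⊥-elim (¬mq (subst C.Member (sym q≡prev) m-prev))

-- Sliding two chains

partAt : List ℕ → ℕ → ℕ
partAt []       _       = 0
partAt (x ∷ xs) zero    = x
partAt (x ∷ xs) (suc n) = partAt xs n

lookup≡partAt : ∀ (xs : List ℕ) (i : Fin (length xs)) → lookup xs i ≡ partAt xs (toℕ i)
lookup≡partAt (x ∷ xs) fzero    = refl
lookup≡partAt (x ∷ xs) (fsuc i) = lookup≡partAt xs i

keyRowCount : List ℕ → ℕ → ℕ
keyRowCount α r = sum< (length α) (λ p → sum< (partAt α p) (λ _ → 𝟙 (p ≟ r)))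

rowCount≡sum< : ∀ α (T : KohnertTableau α) (rowOf : ℕ → ℕ → ℕ) →
  (∀ i c → row T i c ≡ suc (rowOf (toℕ i) (toℕ c))) → ∀ r →
  rowCount T (suc r) ≡ sum< (length α) (λ p → sum< (partAt α p) (λ c → 𝟙 (rowOf p c ≟ r)))
rowCount≡sum< α T rowOf row≡ r = begin
  rowCount T (suc r)
    ≡⟨ sum-map-tabulate (λ i → i) (λ i → length (filter (λ c → row T i c ≟ suc r) (allFin (lookup α i)))) ⟩
  sumFin (length α) (λ i → length (filter (λ c → row T i c ≟ suc r) (allFin (lookup α i))))
    ≡⟨ sumFin-cong (length α) (λ i → trans (length-filter-tabulate (λ c → c) (λ c → row T i c ≟ suc r)) (columns i)) ⟩
  sumFin (length α) (λ i → sum< (partAt α (toℕ i)) (λ c → 𝟙 (rowOf (toℕ i) c ≟ r)))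
    ≡⟨ sumFin-toℕ (length α) (λ p → sum< (partAt α p) (λ c → 𝟙 (rowOf p c ≟ r))) ⟩
  sum< (length α) (λ p → sum< (partAt α p) (λ c → 𝟙 (rowOf p c ≟ r))) ∎
  where
  open ≡-Reasoning
  columns : ∀ i → sumFin (lookup α i) (λ c → 𝟙 (row T i c ≟ suc r)) ≡ sum< (partAt α (toℕ i)) (λ c → 𝟙 (rowOf (toℕ i) c ≟ r))
  columns i = begin
    sumFin (lookup α i) (λ c → 𝟙 (row T i c ≟ suc r))
      ≡⟨ sumFin-cong (lookup α i) (λ c → cong (λ z → 𝟙 (z ≟ suc r)) (row≡ i c)) ⟩
    sumFin (lookup α i) (λ c → 𝟙 (rowOf (toℕ i) (toℕ c) ≟ r))
      ≡⟨ sumFin-toℕ (lookup α i) (λ c → 𝟙 (rowOf (toℕ i) c ≟ r)) ⟩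
    sum< (lookup α i) (λ c → 𝟙 (rowOf (toℕ i) c ≟ r))
      ≡⟨ cong (λ n → sum< n (λ c → 𝟙 (rowOf (toℕ i) c ≟ r))) (lookup≡partAt α i) ⟩
    sum< (partAt α (toℕ i)) (λ c → 𝟙 (rowOf (toℕ i) c ≟ r)) ∎

module TwoChains (α : List ℕ)
  (b₁ : ℕ) (P₁ : ℕ → Set) (P₁? : Decidable P₁) (top₁ x₁ : ℕ)
  (b₂ : ℕ) (P₂ : ℕ → Set) (P₂? : Decidable P₂) (top₂ x₂ : ℕ)
  where

  a : ℕ → ℕ
  a = partAt α

  ℓ : ℕ
  ℓ = length α

  module C₁ = Chain b₁ P₁ P₁? top₁
  module C₂ = Chain b₂ P₂ P₂? top₂
  open C₁ using () renaming (Member to Member₁; member? to member₁?; prev to prev₁)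
  open C₂ using () renaming (Member to Member₂; member? to member₂?; prev to prev₂)

  -- Rows, columns and entries are counted from 0: rowOf p c is the row of entry p+1 in column c+1.
  rowOf : ℕ → ℕ → ℕ
  rowOf p c = if? member₁? p ×-dec (c ≟ x₁) then prev₁ p
              else if? member₂? p ×-dec (c ≟ x₂) then prev₂ p
              else p

  -- What sliding both chains needs to keep condition (iii), condition (iv) and distinct cells.
  record Hyps : Set where
    field
      positive : ∀ p → p < ℓ → 1 ≤ a p
      x₁≥1 : 1 ≤ x₁
      x₂≥1 : 1 ≤ x₂
      x₁<part : ∀ p → Member₁ p → x₁ < a p
      x₂<part : ∀ p → Member₂ p → x₂ < a p
      top₁<ℓ : top₁ < ℓ
      top₂<ℓ : top₂ < ℓ
      top₁-node : C₁.Node top₁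
      top₂-node : C₂.Node top₂
      disjoint : x₁ ≡ x₂ → ∀ p → Member₁ p → Member₂ p → ⊥
      beyond₁ : ∀ p d → Member₁ p → x₁ < d → d < a p → Member₂ p × d ≡ x₂
      beyond₂ : ∀ p d → Member₂ p → x₂ < d → d < a p → Member₁ p × d ≡ x₁
      descend₁₂ : ∀ p → Member₁ p → Member₂ p → x₁ < x₂ → prev₂ p ≤ prev₁ p
      descend₂₁ : ∀ p → Member₁ p → Member₂ p → x₂ < x₁ → prev₁ p ≤ prev₂ p
      base₁-short : ∀ p → Member₁ p → a b₁ ≤ x₁
      base₂-short : ∀ p → Member₂ p → a b₂ ≤ x₂
      lastColumn₁ : ∀ n m → Member₁ n → prev₁ n < m → m < n → a m ≡ suc x₁ → P₁ m ⊎ (Member₂ m × x₂ ≡ x₁)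
      lastColumn₂ : ∀ n m → Member₂ n → prev₂ n < m → m < n → a m ≡ suc x₂ → P₂ m ⊎ (Member₁ m × x₁ ≡ x₂)
      adjacent₁₂ : ∀ n m → Member₁ n → Member₂ m → x₂ ≡ suc x₁ → m < n → prev₁ n < m → ¬ Member₁ m → prev₁ n < prev₂ m
      adjacent₂₁ : ∀ n m → Member₂ n → Member₁ m → x₁ ≡ suc x₂ → m < n → prev₂ n < m → ¬ Member₂ m → prev₂ n < prev₁ m
      cross₁₂ : ∀ n m → Member₁ n → Member₂ m → x₂ ≡ x₁ → m < n → prev₂ m ≤ prev₁ n
      cross₂₁ : ∀ n m → Member₂ n → Member₁ m → x₁ ≡ x₂ → m < n → prev₁ m ≤ prev₂ n
      cross-distinct : ∀ p q → Member₁ p → Member₂ q → x₂ ≡ x₁ → prev₁ p ≢ prev₂ q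

  module _ (H : Hyps) where
    open Hyps H

    rowOf-member₁ : ∀ p c → Member₁ p → c ≡ x₁ → rowOf p c ≡ prev₁ p
    rowOf-member₁ p c m e = if?-yes (member₁? p ×-dec (c ≟ x₁)) (m , e)

    rowOf-member₂ : ∀ p c → Member₂ p → c ≡ x₂ → rowOf p c ≡ prev₂ p
    rowOf-member₂ p c m e =
      trans (if?-no (member₁? p ×-dec (c ≟ x₁)) (λ (m₁ , e₁) → disjoint (trans (sym e₁) e) p m₁ m))
            (if?-yes (member₂? p ×-dec (c ≟ x₂)) (m , e))

    rowOf-unmoved : ∀ p c → ¬ (Member₁ p × c ≡ x₁) → ¬ (Member₂ p × c ≡ x₂) → rowOf p c ≡ p
    rowOf-unmoved p c ¬₁ ¬₂ =
      trans (if?-no (member₁? p ×-dec (c ≟ x₁)) ¬₁) (if?-no (member₂? p ×-dec (c ≟ x₂)) ¬₂)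

    module Side₁ = ChainSide.Properties a rowOf b₁ P₁ P₁? top₁ x₁ b₂ P₂ P₂? top₂ x₂
                     rowOf-member₁ rowOf-member₂ rowOf-unmoved
                     base₁-short lastColumn₁ adjacent₁₂ cross₁₂ cross-distinct
    module Side₂ = ChainSide.Properties a rowOf b₂ P₂ P₂? top₂ x₂ b₁ P₁ P₁? top₁ x₁
                     rowOf-member₂ rowOf-member₁ (λ p c ¬₂ ¬₁ → rowOf-unmoved p c ¬₁ ¬₂)
                     base₂-short lastColumn₂ adjacent₂₁ cross₂₁
                     (λ p q m₂ m₁ e eq → cross-distinct q p m₁ m₂ (sym e) (sym eq))

    rowOf≤entry : ∀ p c → rowOf p c ≤ p
    rowOf≤entry p c with member₁? p ×-dec (c ≟ x₁) | member₂? p ×-dec (c ≟ x₂)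
    ... | yes (m , _) | _           = <⇒≤ (C₁.prev< p (proj₁ m))
    ... | no _        | yes (m , _) = <⇒≤ (C₂.prev< p (proj₁ m))
    ... | no _        | no _        = ≤-refl

    rowOf-firstColumn : ∀ p → rowOf p 0 ≡ p
    rowOf-firstColumn p = rowOf-unmoved p 0 (λ (_ , e) → <-irrefl e x₁≥1) (λ (_ , e) → <-irrefl e x₂≥1)

    rowOf-descend : ∀ p c d → c < d → d < a p → rowOf p d ≤ rowOf p c
    rowOf-descend p c d c<d d<ap with member₁? p ×-dec (c ≟ x₁) | member₂? p ×-dec (c ≟ x₂)
    ... | no _ | no _ = rowOf≤entry p d
    ... | yes (m₁ , refl) | _ with beyond₁ p d m₁ c<d d<ap
    ...   | m₂ , refl = subst (_≤ prev₁ p) (sym (rowOf-member₂ p x₂ m₂ refl)) (descend₁₂ p m₁ m₂ c<d)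
    rowOf-descend p c d c<d d<ap | no _ | yes (m₂ , refl) with beyond₂ p d m₂ c<d d<ap
    ...   | m₁ , refl = subst (_≤ prev₂ p) (sym (rowOf-member₁ p x₁ m₁ refl)) (descend₂₁ p m₁ m₂ c<d)

    rowOf-columnCondition : ∀ m n c → m < n → c < a m → rowOf n c < rowOf m c →
      suc c < a m × rowOf n c < rowOf m (suc c)
    rowOf-columnCondition m n c m<n c<am lt with member₁? n ×-dec (c ≟ x₁) | member₂? n ×-dec (c ≟ x₂)
    ... | yes (mn , refl) | _ =
      let next = Side₁.columnCondition m n mn m<n c<am (subst (_< rowOf m c) (sym (rowOf-member₁ n c mn refl)) lt)
      in proj₁ next , subst (_< rowOf m (suc c)) (rowOf-member₁ n c mn refl) (proj₂ next)
    ... | no _ | yes (mn , refl) =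
      let next = Side₂.columnCondition m n mn m<n c<am (subst (_< rowOf m c) (sym (rowOf-member₂ n c mn refl)) lt)
      in proj₁ next , subst (_< rowOf m (suc c)) (rowOf-member₂ n c mn refl) (proj₂ next)
    ... | no _ | no _ =
      ⊥-elim (<-irrefl refl (<-≤-trans lt (≤-trans (rowOf≤entry m c) (<⇒≤ m<n))))

    rowOf-injective : ∀ p q c → c < a p → c < a q → rowOf p c ≡ rowOf q c → p ≡ q
    rowOf-injective p q c c<ap c<aq eq with member₁? p ×-dec (c ≟ x₁) | member₂? p ×-dec (c ≟ x₂)
    ... | yes (mp , refl) | _ = Side₁.prev-unique p q mp c<aq (sym eq)
    ... | no _ | yes (mp , refl) = Side₂.prev-unique p q mp c<aq (sym eq)
    ... | no ¬₁ | no ¬₂ with member₁? q ×-dec (c ≟ x₁) | member₂? q ×-dec (c ≟ x₂)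
    ...   | yes (mq , refl) | _ =
      sym (Side₁.prev-unique q p mq c<ap (trans (rowOf-unmoved p c ¬₁ ¬₂) eq))
    ...   | no _ | yes (mq , refl) =
      sym (Side₂.prev-unique q p mq c<ap (trans (rowOf-unmoved p c ¬₁ ¬₂) eq))
    ...   | no _ | no _ = eq

    column<part : ∀ (i : Fin ℓ) (c : Fin (lookup α i)) → toℕ c < a (toℕ i)
    column<part i c = subst (toℕ c <_) (lookup≡partAt α i) (toℕ<n c)

    tableau : KohnertTableau α
    tableau = record
      { row       = λ i c → suc (rowOf (toℕ i) (toℕ c))
      ; distinct  = λ i j c d c≡d eq → toℕ-injective
          (rowOf-injective (toℕ i) (toℕ j) (toℕ d) (subst (_< a (toℕ i)) c≡d (column<part i c)) (column<part j d)
             (subst (λ z → rowOf (toℕ i) z ≡ rowOf (toℕ j) (toℕ d)) c≡d (suc-injective eq)))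
      ; rowPos    = λ _ _ → s≤s z≤n
      ; entry≥row = λ i c → s≤s (rowOf≤entry (toℕ i) (toℕ c))
      ; descend   = λ i c d c<d → s≤s (rowOf-descend (toℕ i) (toℕ c) (toℕ d) c<d (column<part i d))
      ; colCond   = columnCondition
      }
      where
      columnCondition : ∀ (i j : Fin ℓ) (c : Fin (lookup α i)) (d : Fin (lookup α j)) →
        toℕ i < toℕ j → toℕ c ≡ toℕ d → suc (rowOf (toℕ j) (toℕ d)) < suc (rowOf (toℕ i) (toℕ c)) →
        Σ[ e ∈ Fin (lookup α i) ] (toℕ e ≡ suc (toℕ d) × suc (rowOf (toℕ j) (toℕ d)) < suc (rowOf (toℕ i) (toℕ e)))
      columnCondition i j c d i<j c≡d lt =
        fromℕ< 1+d<part , toℕ-fromℕ< 1+d<part ,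
        s≤s (subst (λ z → rowOf (toℕ j) (toℕ d) < rowOf (toℕ i) z) (sym (toℕ-fromℕ< 1+d<part)) (proj₂ next))
        where
        next : suc (toℕ d) < a (toℕ i) × rowOf (toℕ j) (toℕ d) < rowOf (toℕ i) (suc (toℕ d))
        next = rowOf-columnCondition (toℕ i) (toℕ j) (toℕ d) i<j (subst (_< a (toℕ i)) c≡d (column<part i c))
                 (subst (λ z → rowOf (toℕ j) (toℕ d) < rowOf (toℕ i) z) c≡d (≤-pred lt))
        1+d<part : suc (toℕ d) < lookup α i
        1+d<part = subst (suc (toℕ d) <_) (sym (lookup≡partAt α i)) (proj₁ next)

    tableau-quasiYamanouchi : QuasiYamanouchi tableau
    tableau-quasiYamanouchi r (i , c , eq) =
      inj₁ (i′ , c′ , trans (cong suc (trans (cong (rowOf (toℕ i′)) (toℕ-fromℕ< 0<part)) (trans (rowOf-firstColumn (toℕ i′)) i′≡p))) eq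
               , trans (cong suc i′≡p) eq)
      where
      p = rowOf (toℕ i) (toℕ c)
      p<ℓ : p < ℓ
      p<ℓ = ≤-<-trans (rowOf≤entry (toℕ i) (toℕ c)) (toℕ<n i)
      i′ : Fin ℓ
      i′ = fromℕ< p<ℓ
      i′≡p : toℕ i′ ≡ p
      i′≡p = toℕ-fromℕ< p<ℓ
      0<part : 0 < lookup α i′
      0<part = subst (0 <_) (sym (trans (lookup≡partAt α i′) (cong a i′≡p))) (positive p p<ℓ)
      c′ : Fin (lookup α i′)
      c′ = fromℕ< 0<part

    entry-balance : ∀ p r →
      sum< (a p) (λ c → 𝟙 (rowOf p c ≟ r)) + 𝟙 (member₁? p ×-dec (p ≟ r)) + 𝟙 (member₂? p ×-dec (p ≟ r))
        ≡ sum< (a p) (λ _ → 𝟙 (p ≟ r)) + 𝟙 (member₁? p ×-dec (prev₁ p ≟ r)) + 𝟙 (member₂? p ×-dec (prev₂ p ≟ r))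
    entry-balance p r = by-cases (member₁? p) (member₂? p)
      where
      unmoved : ℕ → ℕ
      unmoved _ = 𝟙 (p ≟ r)
      moved : ℕ → ℕ
      moved c = 𝟙 (rowOf p c ≟ r)

      by-cases : Dec (Member₁ p) → Dec (Member₂ p) →
        sum< (a p) moved + 𝟙 (member₁? p ×-dec (p ≟ r)) + 𝟙 (member₂? p ×-dec (p ≟ r))
          ≡ sum< (a p) unmoved + 𝟙 (member₁? p ×-dec (prev₁ p ≟ r)) + 𝟙 (member₂? p ×-dec (prev₂ p ≟ r))
      by-cases (no ¬m₁) (no ¬m₂)
        rewrite 𝟙-×-no (member₁? p) (p ≟ r) ¬m₁ | 𝟙-×-no (member₂? p) (p ≟ r) ¬m₂
              | 𝟙-×-no (member₁? p) (prev₁ p ≟ r) ¬m₁ | 𝟙-×-no (member₂? p) (prev₂ p ≟ r) ¬m₂ =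
        cong (λ z → z + 0 + 0)
             (sum<-cong (a p) (λ c _ → cong (λ z → 𝟙 (z ≟ r)) (rowOf-unmoved p c (¬m₁ ∘ proj₁) (¬m₂ ∘ proj₁))))
      by-cases (yes m₁) (no ¬m₂)
        rewrite 𝟙-×-yes (member₁? p) (p ≟ r) m₁ | 𝟙-×-no (member₂? p) (p ≟ r) ¬m₂
              | 𝟙-×-yes (member₁? p) (prev₁ p ≟ r) m₁ | 𝟙-×-no (member₂? p) (prev₂ p ≟ r) ¬m₂ =
        cong (_+ 0) (trans (sum<-update (a p) unmoved moved x₁ (x₁<part p m₁)
                              (λ c _ c≢x₁ → cong (λ z → 𝟙 (z ≟ r)) (rowOf-unmoved p c (c≢x₁ ∘ proj₂) (¬m₂ ∘ proj₁))))
                           (cong (sum< (a p) unmoved +_) (cong (λ z → 𝟙 (z ≟ r)) (rowOf-member₁ p x₁ m₁ refl))))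
      by-cases (no ¬m₁) (yes m₂)
        rewrite 𝟙-×-no (member₁? p) (p ≟ r) ¬m₁ | 𝟙-×-yes (member₂? p) (p ≟ r) m₂
              | 𝟙-×-no (member₁? p) (prev₁ p ≟ r) ¬m₁ | 𝟙-×-yes (member₂? p) (prev₂ p ≟ r) m₂ =
        trans (cong (_+ 𝟙 (p ≟ r)) (+-identityʳ _))
        (trans (sum<-update (a p) unmoved moved x₂ (x₂<part p m₂)
                  (λ c _ c≢x₂ → cong (λ z → 𝟙 (z ≟ r)) (rowOf-unmoved p c (¬m₁ ∘ proj₁) (c≢x₂ ∘ proj₂))))
               (cong₂ _+_ (sym (+-identityʳ _)) (cong (λ z → 𝟙 (z ≟ r)) (rowOf-member₂ p x₂ m₂ refl))))
      by-cases (yes m₁) (yes m₂)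
        rewrite 𝟙-×-yes (member₁? p) (p ≟ r) m₁ | 𝟙-×-yes (member₂? p) (p ≟ r) m₂
              | 𝟙-×-yes (member₁? p) (prev₁ p ≟ r) m₁ | 𝟙-×-yes (member₂? p) (prev₂ p ≟ r) m₂ =
        combine (sum< (a p) moved) (sum< (a p) half-moved) (sum< (a p) unmoved) first-move second-move
        where
        x₁≢x₂ : x₁ ≢ x₂
        x₁≢x₂ e = disjoint e p m₁ m₂

        half-moved : ℕ → ℕ
        half-moved c = if? c ≟ x₁ then 𝟙 (prev₁ p ≟ r) else 𝟙 (p ≟ r)

        first-move : sum< (a p) moved + 𝟙 (p ≟ r) ≡ sum< (a p) half-moved + 𝟙 (prev₂ p ≟ r)
        first-move =
          trans (cong (sum< (a p) moved +_) (sym (if?-no (x₂ ≟ x₁) (x₁≢x₂ ∘ sym))))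
          (trans (sum<-update (a p) half-moved moved x₂ (x₂<part p m₂) agree)
                 (cong (sum< (a p) half-moved +_) (cong (λ z → 𝟙 (z ≟ r)) (rowOf-member₂ p x₂ m₂ refl))))
          where
          agree : ∀ c → c < a p → c ≢ x₂ → moved c ≡ half-moved c
          agree c _ c≢x₂ = by-column (c ≟ x₁)
            where
            by-column : Dec (c ≡ x₁) → moved c ≡ half-moved c
            by-column (yes c≡x₁) =
              trans (cong (λ z → 𝟙 (z ≟ r)) (rowOf-member₁ p c m₁ c≡x₁)) (sym (if?-yes (c ≟ x₁) c≡x₁))
            by-column (no c≢x₁) =
              trans (cong (λ z → 𝟙 (z ≟ r)) (rowOf-unmoved p c (c≢x₁ ∘ proj₂) (c≢x₂ ∘ proj₂))) (sym (if?-no (c ≟ x₁) c≢x₁))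

        second-move : sum< (a p) half-moved + 𝟙 (p ≟ r) ≡ sum< (a p) unmoved + 𝟙 (prev₁ p ≟ r)
        second-move = trans (sum<-update (a p) unmoved half-moved x₁ (x₁<part p m₁) (λ c _ c≢x₁ → if?-no (c ≟ x₁) c≢x₁))
                            (cong (sum< (a p) unmoved +_) (if?-yes (x₁ ≟ x₁) refl))

        combine : ∀ M H U {i j k} → M + i ≡ H + k → H + i ≡ U + j → M + i + i ≡ U + j + k
        combine M H U {i} {j} {k} e₁ e₂ rewrite e₁ = trans (swap H k i) (cong (_+ k) e₂)
          where
          swap : ∀ H k i → H + k + i ≡ H + i + k
          swap = solve-∀

    rowCount-balance : ∀ r →
      rowCount tableau (suc r) + (𝟙 (r ≟ top₁) + 𝟙 (r ≟ top₂)) ≡ keyRowCount α r + (𝟙 (r ≟ b₁) + 𝟙 (r ≟ b₂))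
    rowCount-balance r =
      trans (cong (_+ (t₁ + t₂)) (rowCount≡sum< α tableau rowOf (λ _ _ → refl) r))
            (+-cancelʳ-≡ (m₁ + m₂) _ _ (begin
              N + (t₁ + t₂) + (m₁ + m₂)        ≡⟨ shuffle₁ N t₁ t₂ m₁ m₂ ⟩
              N + m₁ + m₂ + (t₁ + t₂)          ≡⟨ cong (_+ (t₁ + t₂)) entries ⟩
              K + J₁ + J₂ + (t₁ + t₂)          ≡⟨ shuffle₂ K J₁ J₂ t₁ t₂ ⟩
              K + ((J₁ + t₁) + (J₂ + t₂))      ≡⟨ cong₂ (λ u v → K + (u + v)) (C₁.fibre-count ℓ r top₁<ℓ top₁-node) (C₂.fibre-count ℓ r top₂<ℓ top₂-node) ⟩
              K + ((β₁ + m₁) + (β₂ + m₂))      ≡⟨ shuffle₃ K β₁ m₁ β₂ m₂ ⟩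
              K + (β₁ + β₂) + (m₁ + m₂)        ∎))
      where
      open ≡-Reasoning
      N  = sum< ℓ (λ p → sum< (a p) (λ c → 𝟙 (rowOf p c ≟ r)))
      K  = keyRowCount α r
      m₁ = 𝟙 (member₁? r)
      m₂ = 𝟙 (member₂? r)
      J₁ = C₁.fibre ℓ r
      J₂ = C₂.fibre ℓ r
      t₁ = 𝟙 (r ≟ top₁)
      t₂ = 𝟙 (r ≟ top₂)
      β₁ = 𝟙 (r ≟ b₁)
      β₂ = 𝟙 (r ≟ b₂)

      split₃ : ∀ (u v w : ℕ → ℕ) → sum< ℓ (λ p → u p + v p + w p) ≡ sum< ℓ u + sum< ℓ v + sum< ℓ w
      split₃ u v w = trans (sum<-+ ℓ (λ p → u p + v p) w) (cong (_+ sum< ℓ w) (sum<-+ ℓ u v))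

      entries : N + m₁ + m₂ ≡ K + J₁ + J₂
      entries = begin
        N + m₁ + m₂
          ≡⟨ sym (cong₂ (λ u v → N + u + v) (C₁.fibre-diagonal ℓ r top₁<ℓ) (C₂.fibre-diagonal ℓ r top₂<ℓ)) ⟩
        N + sum< ℓ (λ p → 𝟙 (member₁? p ×-dec (p ≟ r))) + sum< ℓ (λ p → 𝟙 (member₂? p ×-dec (p ≟ r)))
          ≡⟨ sym (split₃ _ _ _) ⟩
        sum< ℓ (λ p → sum< (a p) (λ c → 𝟙 (rowOf p c ≟ r)) + 𝟙 (member₁? p ×-dec (p ≟ r)) + 𝟙 (member₂? p ×-dec (p ≟ r)))
          ≡⟨ sum<-cong ℓ (λ p _ → entry-balance p r) ⟩
        sum< ℓ (λ p → sum< (a p) (λ _ → 𝟙 (p ≟ r)) + 𝟙 (member₁? p ×-dec (prev₁ p ≟ r)) + 𝟙 (member₂? p ×-dec (prev₂ p ≟ r)))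
          ≡⟨ split₃ _ _ _ ⟩
        K + J₁ + J₂ ∎

      shuffle₁ : ∀ N t₁ t₂ m₁ m₂ → N + (t₁ + t₂) + (m₁ + m₂) ≡ N + m₁ + m₂ + (t₁ + t₂)
      shuffle₁ = solve-∀
      shuffle₂ : ∀ K J₁ J₂ t₁ t₂ → K + J₁ + J₂ + (t₁ + t₂) ≡ K + ((J₁ + t₁) + (J₂ + t₂))
      shuffle₂ = solve-∀
      shuffle₃ : ∀ K β₁ m₁ β₂ m₂ → K + ((β₁ + m₁) + (β₂ + m₂)) ≡ K + (β₁ + β₂) + (m₁ + m₂)
      shuffle₃ = solve-∀

balance-cancel : ∀ K {N₁ N₂ t₁ β₁ t₂ β₂} → N₁ + t₁ ≡ K + β₁ → N₂ + t₂ ≡ K + β₂ → t₁ + β₂ ≡ t₂ + β₁ → N₁ ≡ N₂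
balance-cancel K {N₁} {N₂} {t₁} {β₁} {t₂} {β₂} e₁ e₂ e = +-cancelʳ-≡ (t₁ + β₂) N₁ N₂ (begin
  N₁ + (t₁ + β₂)  ≡⟨ sym (+-assoc N₁ t₁ β₂) ⟩
  N₁ + t₁ + β₂    ≡⟨ cong (_+ β₂) e₁ ⟩
  K + β₁ + β₂     ≡⟨ +-assoc K β₁ β₂ ⟩
  K + (β₁ + β₂)   ≡⟨ cong (K +_) (+-comm β₁ β₂) ⟩
  K + (β₂ + β₁)   ≡⟨ sym (+-assoc K β₂ β₁) ⟩
  K + β₂ + β₁     ≡⟨ cong (_+ β₁) (sym e₂) ⟩
  N₂ + t₂ + β₁    ≡⟨ +-assoc N₂ t₂ β₁ ⟩
  N₂ + (t₂ + β₁)  ≡⟨ cong (N₂ +_) (sym e) ⟩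
  N₂ + (t₁ + β₂)  ∎)
  where open ≡-Reasoning

twins⇒¬multiplicityFree : ∀ α (T U : KohnertTableau α) (rowT rowU : ℕ → ℕ → ℕ) →
  (∀ i c → row T i c ≡ suc (rowT (toℕ i) (toℕ c))) → (∀ i c → row U i c ≡ suc (rowU (toℕ i) (toℕ c))) →
  QuasiYamanouchi T → QuasiYamanouchi U → (∀ r → rowCount T (suc r) ≡ rowCount U (suc r)) →
  ∀ p c → p < length α → c < partAt α p → rowT p c ≢ rowU p c → ¬ MultiplicityFree α
twins⇒¬multiplicityFree α T U rowT rowU rowT≡ rowU≡ qT qU counts p c p<ℓ c<part differ mf =
  differ (suc-injective (begin
    suc (rowT p c)              ≡⟨ cong₂ (λ q e → suc (rowT q e)) (sym i≡p) (sym d≡c) ⟩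
    suc (rowT (toℕ i) (toℕ d))  ≡⟨ sym (rowT≡ i d) ⟩
    row T i d                   ≡⟨ mf T U qT qU (tabulate-cong (λ r → counts (toℕ r))) i d ⟩
    row U i d                   ≡⟨ rowU≡ i d ⟩
    suc (rowU (toℕ i) (toℕ d))  ≡⟨ cong₂ (λ q e → suc (rowU q e)) i≡p d≡c ⟩
    suc (rowU p c)              ∎))
  where
  open ≡-Reasoning
  i : Fin (length α)
  i = fromℕ< p<ℓ
  i≡p : toℕ i ≡ p
  i≡p = toℕ-fromℕ< p<ℓ
  c<lookup : c < lookup α i
  c<lookup = subst (c <_) (sym (trans (lookup≡partAt α i) (cong (partAt α) i≡p))) c<part
  d : Fin (lookup α i)
  d = fromℕ< c<lookup
  d≡c : toℕ d ≡ c
  d≡c = toℕ-fromℕ< c<lookup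

positive-parts : ∀ α → StrongComposition α → ∀ p → p < length α → 1 ≤ partAt α p
positive-parts (_ ∷ _) (0<x ∷ _)      zero    _         = 0<x
positive-parts (_ ∷ α) (_   ∷ strong) (suc p) (s≤s p<ℓ) = positive-parts α strong p p<ℓ

-- The three patterns

module Patterns (α : List ℕ) (strong : StrongComposition α) where

  a : ℕ → ℕ
  a = partAt α

  ℓ : ℕ
  ℓ = length α

  positive : ∀ p → p < ℓ → 1 ≤ a p
  positive = positive-parts α strong

  EndsAt : ℕ → ℕ → Set
  EndsAt x p = a p ≡ suc x

  endsAt? : ∀ x → Decidable (EndsAt x)
  endsAt? x p = a p ≟ suc x

  endsAt-last : ∀ p → 0 < a p → EndsAt (pred (a p)) p
  endsAt-last p 0<ap = sym (suc-pred (a p) {{>-nonZero 0<ap}})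

  endsAt⇒< : ∀ {x p} → EndsAt x p → x < a p
  endsAt⇒< {x} e = subst (x <_) (sym e) ≤-refl

  endsAt-nothing-beyond : ∀ {x p d} → EndsAt x p → x < d → d < a p → ⊥
  endsAt-nothing-beyond {d = d} e x<d d<ap = <-irrefl refl (<-≤-trans x<d (≤-pred (subst (d <_) e d<ap)))

  endsAt-unique : ∀ {x y p} → EndsAt x p → EndsAt y p → x ≡ y
  endsAt-unique e e′ = suc-injective (trans (sym e) e′)

  module Case₁ (i j k : ℕ) (i<j : i < j) (j<k : j < k) (k<ℓ : k < ℓ) (ai<aj : a i < a j) (aj<ak : a j < a k) where
    xj = pred (a j)
    xk = pred (a k)
    j<ℓ = <-trans j<k k<ℓ
    i<ℓ = <-trans i<j j<ℓ

    ej : EndsAt xj j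
    ej = endsAt-last j (≤-<-trans z≤n ai<aj)
    ek : EndsAt xk k
    ek = endsAt-last k (≤-<-trans z≤n aj<ak)

    xj<xk : xj < xk
    xj<xk = ≤-pred (subst₂ _<_ ej ek aj<ak)
    xj≥1 : 1 ≤ xj
    xj≥1 = ≤-pred (subst (2 ≤_) ej (≤-trans (s≤s (positive i i<ℓ)) ai<aj))
    xk≥1 : 1 ≤ xk
    xk≥1 = ≤-trans xj≥1 (<⇒≤ xj<xk)
    xj≢xk : xj ≢ xk
    xj≢xk e = <-irrefl e xj<xk

    module T₁ = TwoChains α i (EndsAt xj) (endsAt? xj) j xj j (EndsAt xk) (endsAt? xk) k xk
    H₁ : T₁.Hyps
    H₁ = record
      { positive = positive ; x₁≥1 = xj≥1 ; x₂≥1 = xk≥1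
      ; x₁<part = λ _ (_ , _ , e) → endsAt⇒< e
      ; x₂<part = λ _ (_ , _ , e) → endsAt⇒< e
      ; top₁<ℓ = j<ℓ ; top₂<ℓ = k<ℓ
      ; top₁-node = inj₂ (i<j , ≤-refl , ej) ; top₂-node = inj₂ (j<k , ≤-refl , ek)
      ; disjoint = λ e _ _ _ → xj≢xk e
      ; beyond₁ = λ _ _ (_ , _ , e) x<d d<a → ⊥-elim (endsAt-nothing-beyond e x<d d<a)
      ; beyond₂ = λ _ _ (_ , _ , e) x<d d<a → ⊥-elim (endsAt-nothing-beyond e x<d d<a)
      ; descend₁₂ = λ _ (_ , _ , e) (_ , _ , e′) _ → ⊥-elim (xj≢xk (endsAt-unique e e′))
      ; descend₂₁ = λ _ (_ , _ , e) (_ , _ , e′) _ → ⊥-elim (xj≢xk (endsAt-unique e e′))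
      ; base₁-short = λ _ _ → ≤-pred (subst (a i <_) ej ai<aj)
      ; base₂-short = λ _ _ → ≤-pred (subst (a j <_) ek aj<ak)
      ; lastColumn₁ = λ _ _ _ _ _ e → inj₁ e
      ; lastColumn₂ = λ _ _ _ _ _ e → inj₁ e
      ; adjacent₁₂ = λ _ _ (_ , n≤j , _) (j<m , _) _ m<n _ _ → ⊥-elim (<-irrefl refl (<-trans j<m (<-≤-trans m<n n≤j)))
      ; adjacent₂₁ = λ _ _ _ _ e _ _ _ → ⊥-elim (<-irrefl refl (<-trans (subst (_< xk) e xj<xk) (n<1+n xk)))
      ; cross₁₂ = λ _ _ _ _ e _ → ⊥-elim (xj≢xk (sym e))
      ; cross₂₁ = λ _ _ _ _ e _ → ⊥-elim (xj≢xk e)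
      ; cross-distinct = λ _ _ _ _ e _ → xj≢xk (sym e)
      }

    module T₂ = TwoChains α i (EndsAt xk) (endsAt? xk) k xk 0 ∅ ∅? 0 1
    H₂ : T₂.Hyps
    H₂ = record
      { positive = positive ; x₁≥1 = xk≥1 ; x₂≥1 = ≤-refl
      ; x₁<part = λ _ (_ , _ , e) → endsAt⇒< e
      ; x₂<part = λ { _ (_ , _ , ()) }
      ; top₁<ℓ = k<ℓ ; top₂<ℓ = ≤-<-trans z≤n k<ℓ
      ; top₁-node = inj₂ (<-trans i<j j<k , ≤-refl , ek) ; top₂-node = inj₁ refl
      ; disjoint = λ { _ _ _ (_ , _ , ()) }
      ; beyond₁ = λ _ _ (_ , _ , e) x<d d<a → ⊥-elim (endsAt-nothing-beyond e x<d d<a)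
      ; beyond₂ = λ { _ _ (_ , _ , ()) }
      ; descend₁₂ = λ { _ _ (_ , _ , ()) }
      ; descend₂₁ = λ { _ _ (_ , _ , ()) }
      ; base₁-short = λ _ _ → ≤-pred (subst (a i <_) ek (<-trans ai<aj aj<ak))
      ; base₂-short = λ { _ (_ , _ , ()) }
      ; lastColumn₁ = λ _ _ _ _ _ e → inj₁ e
      ; lastColumn₂ = λ { _ _ (_ , _ , ()) }
      ; adjacent₁₂ = λ { _ _ _ (_ , _ , ()) }
      ; adjacent₂₁ = λ { _ _ (_ , _ , ()) }
      ; cross₁₂ = λ { _ _ _ (_ , _ , ()) }
      ; cross₂₁ = λ { _ _ (_ , _ , ()) }
      ; cross-distinct = λ { _ _ _ (_ , _ , ()) }
      }

    same-ends : ∀ I J K Z → (J + K) + (I + Z) ≡ (K + Z) + (I + J)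
    same-ends = solve-∀

    result : ¬ MultiplicityFree α
    result = twins⇒¬multiplicityFree α (T₁.tableau H₁) (T₂.tableau H₂) T₁.rowOf T₂.rowOf (λ _ _ → refl) (λ _ _ → refl)
      (T₁.tableau-quasiYamanouchi H₁) (T₂.tableau-quasiYamanouchi H₂)
      (λ r → balance-cancel (keyRowCount α r) (T₁.rowCount-balance H₁ r) (T₂.rowCount-balance H₂ r)
               (same-ends (𝟙 (r ≟ i)) (𝟙 (r ≟ j)) (𝟙 (r ≟ k)) (𝟙 (r ≟ 0))))
      j xj j<ℓ (endsAt⇒< ej) differ
      where
      differ : T₁.rowOf j xj ≢ T₂.rowOf j xj
      differ e = <-irrefl (trans (sym moved) (trans e unmoved)) (T₁.C₁.prev< j i<j)
        where
        moved : T₁.rowOf j xj ≡ T₁.C₁.prev j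
        moved = T₁.rowOf-member₁ H₁ j xj (i<j , ≤-refl , ej) refl
        unmoved : T₂.rowOf j xj ≡ j
        unmoved = T₂.rowOf-unmoved H₂ j xj (λ ((_ , _ , e′) , _) → xj≢xk (endsAt-unique ej e′)) (λ { ((_ , _ , ()) , _) })

  module Case₃ (i j k l : ℕ) (i<j : i < j) (j<k : j < k) (k<l : k < l) (l<ℓ : l < ℓ)
               (ai<ak : a i < a k) (aj+1<ak : suc (a j) < a k) (al≡ak : a l ≡ a k)
               (gap-k : ∀ m → j < m → m < k → a m ≢ a k) (gap-l : ∀ m → k < m → m < l → a m ≢ a k) where
    x = pred (a k)
    y = pred x
    k<ℓ = <-trans k<l l<ℓ
    i<k = <-trans i<j j<k

    ek : EndsAt x k
    ek = endsAt-last k (≤-<-trans z≤n aj+1<ak)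
    el : EndsAt x l
    el = trans al≡ak ek

    x≥2 : 2 ≤ x
    x≥2 = ≤-pred (subst (3 ≤_) ek (≤-trans (s≤s (s≤s (positive j (<-trans j<k k<ℓ)))) aj+1<ak))
    x≥1 : 1 ≤ x
    x≥1 = ≤-trans (s≤s z≤n) x≥2
    x≡1+y : x ≡ suc y
    x≡1+y = sym (suc-pred x {{>-nonZero x≥1}})
    y≥1 : 1 ≤ y
    y≥1 = ≤-pred (subst (2 ≤_) x≡1+y x≥2)
    y<x : y < x
    y<x = subst (y <_) (sym x≡1+y) ≤-refl
    x≢y : x ≢ y
    x≢y e = <-irrefl (sym e) y<x

    aj<ak : a j < a k
    aj<ak = <-trans (n<1+n (a j)) aj+1<ak

    below-j : ∀ m → m < k → EndsAt x m → m < j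
    below-j m m<k em with <-cmp m j
    ... | tri< m<j _ _ = m<j
    ... | tri≈ _ refl _ = ⊥-elim (<-irrefl (trans em (sym ek)) aj<ak)
    ... | tri> _ _ j<m = ⊥-elim (gap-k m j<m m<k (trans em (sym ek)))

    module Lower (top : ℕ) = Chain i (EndsAt x) (endsAt? x) top

    prev-k<j : ∀ top → Lower.prev top k < j
    prev-k<j top = Lower.prev<-gap top k j i<j i<k (λ m j≤m m<k em → <-irrefl refl (<-≤-trans (below-j m m<k em) j≤m))

    prev<j : ∀ top m → i < m → m ≤ k → EndsAt x m → Lower.prev top m < j
    prev<j top m i<m m≤k em with m≤n⇒m<n∨m≡n m≤k
    ... | inj₂ refl = prev-k<j top
    ... | inj₁ m<k  = <-trans (Lower.prev< top m i<m) (below-j m m<k em)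

    module T₁ = TwoChains α j (EndsAt y ∪ (_≡ k)) (endsAt? y ∪? (_≟ k)) k y i (EndsAt x) (endsAt? x) l x
    H₁ : T₁.Hyps
    H₁ = record
      { positive = positive ; x₁≥1 = y≥1 ; x₂≥1 = x≥1
      ; x₁<part = y<part
      ; x₂<part = λ _ (_ , _ , e) → endsAt⇒< e
      ; top₁<ℓ = k<ℓ ; top₂<ℓ = l<ℓ
      ; top₁-node = inj₂ (j<k , ≤-refl , inj₂ refl) ; top₂-node = inj₂ (<-trans i<k k<l , ≤-refl , el)
      ; disjoint = λ e _ _ _ → x≢y (sym e)
      ; beyond₁ = beyond
      ; beyond₂ = λ _ _ (_ , _ , e) x<d d<a → ⊥-elim (endsAt-nothing-beyond e x<d d<a)
      ; descend₁₂ = descends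
      ; descend₂₁ = λ _ _ _ x<y → ⊥-elim (<-irrefl refl (<-trans x<y y<x))
      ; base₁-short = λ _ _ → ≤-pred (≤-pred (subst (suc (a j) <_) (trans ek (cong suc x≡1+y)) aj+1<ak))
      ; base₂-short = λ _ _ → ≤-pred (subst (a i <_) ek ai<ak)
      ; lastColumn₁ = λ _ _ _ _ _ e → inj₁ (inj₁ e)
      ; lastColumn₂ = λ _ _ _ _ _ e → inj₁ e
      ; adjacent₁₂ = adjacent
      ; adjacent₂₁ = λ _ _ _ _ e _ _ _ → ⊥-elim (<-irrefl e (<-trans y<x (n<1+n x)))
      ; cross₁₂ = λ _ _ _ _ e _ → ⊥-elim (x≢y e)
      ; cross₂₁ = λ _ _ _ _ e _ → ⊥-elim (x≢y (sym e))
      ; cross-distinct = λ _ _ _ _ e _ → x≢y e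
      }
      where
      y<part : ∀ p → T₁.C₁.Member p → y < a p
      y<part p (_ , _ , inj₁ e)    = endsAt⇒< e
      y<part p (_ , _ , inj₂ refl) = subst (y <_) (sym (trans ek (cong suc x≡1+y))) (n≤1+n (suc y))

      beyond : ∀ p d → T₁.C₁.Member p → y < d → d < a p → T₁.C₂.Member p × d ≡ x
      beyond p d (_ , _ , inj₁ e)    y<d d<a = ⊥-elim (endsAt-nothing-beyond e y<d d<a)
      beyond p d (_ , _ , inj₂ refl) y<d d<a =
        (i<k , <⇒≤ k<l , ek) , ≤-antisym (≤-pred (subst (d <_) ek d<a)) (subst (_≤ d) (sym x≡1+y) y<d)

      descends : ∀ p → T₁.C₁.Member p → T₁.C₂.Member p → y < x → T₁.C₂.prev p ≤ T₁.C₁.prev p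
      descends p (_ , _ , inj₁ e)    (_ , _ , e′) _ = ⊥-elim (x≢y (endsAt-unique e′ e))
      descends p (_ , _ , inj₂ refl) _           _ = <⇒≤ (<-≤-trans (prev-k<j l) (T₁.C₁.base≤prev k))

      adjacent : ∀ n m → T₁.C₁.Member n → T₁.C₂.Member m → x ≡ suc y → m < n → T₁.C₁.prev n < m →
        ¬ T₁.C₁.Member m → T₁.C₁.prev n < T₁.C₂.prev m
      adjacent n m (_ , n≤k , _) (_ , _ , em) _ m<n prev<m _ =
        ⊥-elim (<-irrefl refl (<-trans prev<m (<-≤-trans (below-j m (<-≤-trans m<n n≤k) em) (T₁.C₁.base≤prev n))))

    module T₂ = TwoChains α i (EndsAt x) (endsAt? x) k x j (_≡ l) (_≟ l) l x
    H₂ : T₂.Hyps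
    H₂ = record
      { positive = positive ; x₁≥1 = x≥1 ; x₂≥1 = x≥1
      ; x₁<part = λ _ (_ , _ , e) → endsAt⇒< e
      ; x₂<part = λ { _ (_ , _ , refl) → endsAt⇒< el }
      ; top₁<ℓ = k<ℓ ; top₂<ℓ = l<ℓ
      ; top₁-node = inj₂ (i<k , ≤-refl , ek) ; top₂-node = inj₂ (<-trans j<k k<l , ≤-refl , refl)
      ; disjoint = λ { _ _ (_ , p≤k , _) (_ , _ , refl) → <-irrefl refl (<-≤-trans k<l p≤k) }
      ; beyond₁ = λ _ _ (_ , _ , e) x<d d<a → ⊥-elim (endsAt-nothing-beyond e x<d d<a)
      ; beyond₂ = λ { _ _ (_ , _ , refl) x<d d<a → ⊥-elim (endsAt-nothing-beyond el x<d d<a) }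
      ; descend₁₂ = λ _ _ _ x<x → ⊥-elim (<-irrefl refl x<x)
      ; descend₂₁ = λ _ _ _ x<x → ⊥-elim (<-irrefl refl x<x)
      ; base₁-short = λ _ _ → ≤-pred (subst (a i <_) ek ai<ak)
      ; base₂-short = λ _ _ → ≤-pred (subst (a j <_) ek aj<ak)
      ; lastColumn₁ = λ _ _ _ _ _ e → inj₁ e
      ; lastColumn₂ = lastColumn
      ; adjacent₁₂ = λ _ _ _ _ e _ _ _ → ⊥-elim (<-irrefl e (n<1+n x))
      ; adjacent₂₁ = λ _ _ _ _ e _ _ _ → ⊥-elim (<-irrefl e (n<1+n x))
      ; cross₁₂ = λ { _ _ (_ , n≤k , _) (_ , _ , refl) _ l<n → ⊥-elim (<-irrefl refl (<-trans k<l (<-≤-trans l<n n≤k))) }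
      ; cross₂₁ = λ { _ m (_ , _ , refl) (i<m , m≤k , em) _ _ → <⇒≤ (<-≤-trans (prev<j k m i<m m≤k em) (T₂.C₂.base≤prev l)) }
      ; cross-distinct = λ { p _ (i<p , p≤k , ep) (_ , _ , refl) _ e →
                               <-irrefl e (<-≤-trans (prev<j k p i<p p≤k ep) (T₂.C₂.base≤prev l)) }
      }
      where
      lastColumn : ∀ n m → T₂.C₂.Member n → T₂.C₂.prev n < m → m < n → EndsAt x m → m ≡ l ⊎ (T₂.C₁.Member m × x ≡ x)
      lastColumn n m (_ , _ , refl) prev<m m<l em with <-cmp m k
      ... | tri< m<k _ _ = ⊥-elim (gap-k m (≤-<-trans (T₂.C₂.base≤prev l) prev<m) m<k (trans em (sym ek)))
      ... | tri≈ _ refl _ = inj₂ ((i<k , ≤-refl , em) , refl)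
      ... | tri> _ _ k<m = ⊥-elim (gap-l m k<m m<l (trans em (sym ek)))

    same-ends : ∀ I J K L → (K + L) + (I + J) ≡ (K + L) + (J + I)
    same-ends = solve-∀

    result : ¬ MultiplicityFree α
    result = twins⇒¬multiplicityFree α (T₁.tableau H₁) (T₂.tableau H₂) T₁.rowOf T₂.rowOf (λ _ _ → refl) (λ _ _ → refl)
      (T₁.tableau-quasiYamanouchi H₁) (T₂.tableau-quasiYamanouchi H₂)
      (λ r → balance-cancel (keyRowCount α r) (T₁.rowCount-balance H₁ r) (T₂.rowCount-balance H₂ r)
               (same-ends (𝟙 (r ≟ i)) (𝟙 (r ≟ j)) (𝟙 (r ≟ k)) (𝟙 (r ≟ l))))
      l x l<ℓ (endsAt⇒< el) differ
      where
      k≤prev₁ : k ≤ T₁.C₂.prev l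
      k≤prev₁ = T₁.C₂.member≤prev l (i<k , <⇒≤ k<l , ek) k<l
      prev₂≡j : T₂.C₂.prev l ≡ j
      prev₂≡j = T₂.C₂.prev≡-gap l j (inj₁ refl) (<-trans j<k k<l) (λ { _ _ m<l refl → <-irrefl refl m<l })
      differ : T₁.rowOf l x ≢ T₂.rowOf l x
      differ e = <-irrefl refl (<-≤-trans j<k (subst (k ≤_) rows k≤prev₁))
        where
        rows : T₁.C₂.prev l ≡ j
        rows = trans (sym (T₁.rowOf-member₂ H₁ l x (<-trans i<k k<l , ≤-refl , el) refl))
                 (trans e (trans (T₂.rowOf-member₂ H₂ l x (<-trans j<k k<l , ≤-refl , refl) refl) prev₂≡j))

  module Case₂ (i j k l : ℕ) (i<j : i < j) (j<k : j < k) (k<l : k < l) (l<ℓ : l < ℓ)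
               (ai<al : a i < a l) (aj<al : a j < a l) (al<ak : a l < a k)
               (gap-k : ∀ m → j < m → m < k → a m ≢ a k) where
    k<ℓ = <-trans k<l l<ℓ
    i<k = <-trans i<j j<k
    i<l = <-trans i<k k<l
    j<l = <-trans j<k k<l
    aj<ak = <-trans aj<al al<ak
    ai<ak = <-trans ai<al al<ak

    gap-k′ : ∀ m → j ≤ m → m < k → a m ≢ a k
    gap-k′ m j≤m m<k e with m≤n⇒m<n∨m≡n j≤m
    ... | inj₁ j<m = gap-k m j<m m<k e
    ... | inj₂ refl = <-irrefl e aj<ak

    xk = pred (a k)
    xl = pred (a l)
    ek : EndsAt xk k
    ek = endsAt-last k (≤-<-trans z≤n al<ak)
    el : EndsAt xl l
    el = endsAt-last l (≤-<-trans z≤n ai<al)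
    xl≥1 : 1 ≤ xl
    xl≥1 = ≤-pred (subst (2 ≤_) el (≤-trans (s≤s (positive i (<-trans i<l l<ℓ))) ai<al))
    xl<xk : xl < xk
    xl<xk = ≤-pred (subst₂ _<_ el ek al<ak)
    xk≥1 : 1 ≤ xk
    xk≥1 = ≤-trans xl≥1 (<⇒≤ xl<xk)

    prev-k<j : ∀ b top x → b < j → EndsAt x k → Chain.prev b (EndsAt x) (endsAt? x) top k < j
    prev-k<j b top x b<j ekx = Chain.prev<-gap b (EndsAt x) (endsAt? x) top k j b<j (<-trans b<j j<k)
                                 (λ m j≤m m<k em → gap-k′ m j≤m m<k (trans em (sym ekx)))

    prev-k≡j : ∀ top x → EndsAt x k → Chain.prev j (EndsAt x) (endsAt? x) top k ≡ j
    prev-k≡j top x ekx = Chain.prev≡-gap j (EndsAt x) (endsAt? x) top k j (inj₁ refl) j<k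
                           (λ m j<m m<k em → gap-k m j<m m<k (trans em (sym ekx)))

    module Wide (1+al<ak : suc (a l) < a k) where
      1+xl<xk : suc xl < xk
      1+xl<xk = ≤-pred (subst₂ (λ u v → suc u < v) el ek 1+al<ak)
      xk≢xl : xk ≢ xl
      xk≢xl e = <-irrefl (sym e) xl<xk

      module T₁ = TwoChains α i (EndsAt xk) (endsAt? xk) k xk j (EndsAt xl) (endsAt? xl) l xl
      module T₂ = TwoChains α j (EndsAt xk) (endsAt? xk) k xk i (EndsAt xl) (endsAt? xl) l xl

      H₁ : T₁.Hyps
      H₁ = record
        { positive = positive ; x₁≥1 = xk≥1 ; x₂≥1 = xl≥1
        ; x₁<part = λ _ (_ , _ , e) → endsAt⇒< e
        ; x₂<part = λ _ (_ , _ , e) → endsAt⇒< e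
        ; top₁<ℓ = k<ℓ ; top₂<ℓ = l<ℓ
        ; top₁-node = inj₂ (i<k , ≤-refl , ek) ; top₂-node = inj₂ (j<l , ≤-refl , el)
        ; disjoint = λ e _ _ _ → xk≢xl e
        ; beyond₁ = λ _ _ (_ , _ , e) x<d d<a → ⊥-elim (endsAt-nothing-beyond e x<d d<a)
        ; beyond₂ = λ _ _ (_ , _ , e) x<d d<a → ⊥-elim (endsAt-nothing-beyond e x<d d<a)
        ; descend₁₂ = λ _ (_ , _ , e) (_ , _ , e′) _ → ⊥-elim (xk≢xl (endsAt-unique e e′))
        ; descend₂₁ = λ _ (_ , _ , e) (_ , _ , e′) _ → ⊥-elim (xk≢xl (endsAt-unique e e′))
        ; base₁-short = λ _ _ → ≤-pred (subst (a i <_) ek ai<ak)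
        ; base₂-short = λ _ _ → ≤-pred (subst (a j <_) el aj<al)
        ; lastColumn₁ = λ _ _ _ _ _ e → inj₁ e
        ; lastColumn₂ = λ _ _ _ _ _ e → inj₁ e
        ; adjacent₁₂ = λ _ _ _ _ e _ _ _ → ⊥-elim (<-irrefl e (<-trans xl<xk (n<1+n xk)))
        ; adjacent₂₁ = λ _ _ _ _ e _ _ _ → ⊥-elim (<-irrefl (sym e) 1+xl<xk)
        ; cross₁₂ = λ _ _ _ _ e _ → ⊥-elim (xk≢xl (sym e))
        ; cross₂₁ = λ _ _ _ _ e _ → ⊥-elim (xk≢xl e)
        ; cross-distinct = λ _ _ _ _ e _ → xk≢xl (sym e)
        }

      H₂ : T₂.Hyps
      H₂ = record
        { positive = positive ; x₁≥1 = xk≥1 ; x₂≥1 = xl≥1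
        ; x₁<part = λ _ (_ , _ , e) → endsAt⇒< e
        ; x₂<part = λ _ (_ , _ , e) → endsAt⇒< e
        ; top₁<ℓ = k<ℓ ; top₂<ℓ = l<ℓ
        ; top₁-node = inj₂ (j<k , ≤-refl , ek) ; top₂-node = inj₂ (i<l , ≤-refl , el)
        ; disjoint = λ e _ _ _ → xk≢xl e
        ; beyond₁ = λ _ _ (_ , _ , e) x<d d<a → ⊥-elim (endsAt-nothing-beyond e x<d d<a)
        ; beyond₂ = λ _ _ (_ , _ , e) x<d d<a → ⊥-elim (endsAt-nothing-beyond e x<d d<a)
        ; descend₁₂ = λ _ (_ , _ , e) (_ , _ , e′) _ → ⊥-elim (xk≢xl (endsAt-unique e e′))
        ; descend₂₁ = λ _ (_ , _ , e) (_ , _ , e′) _ → ⊥-elim (xk≢xl (endsAt-unique e e′))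
        ; base₁-short = λ _ _ → ≤-pred (subst (a j <_) ek aj<ak)
        ; base₂-short = λ _ _ → ≤-pred (subst (a i <_) el ai<al)
        ; lastColumn₁ = λ _ _ _ _ _ e → inj₁ e
        ; lastColumn₂ = λ _ _ _ _ _ e → inj₁ e
        ; adjacent₁₂ = λ _ _ _ _ e _ _ _ → ⊥-elim (<-irrefl e (<-trans xl<xk (n<1+n xk)))
        ; adjacent₂₁ = λ _ _ _ _ e _ _ _ → ⊥-elim (<-irrefl (sym e) 1+xl<xk)
        ; cross₁₂ = λ _ _ _ _ e _ → ⊥-elim (xk≢xl (sym e))
        ; cross₂₁ = λ _ _ _ _ e _ → ⊥-elim (xk≢xl e)
        ; cross-distinct = λ _ _ _ _ e _ → xk≢xl (sym e)
        }

      same-ends : ∀ I J K L → (K + L) + (J + I) ≡ (K + L) + (I + J)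
      same-ends = solve-∀

      result : ¬ MultiplicityFree α
      result = twins⇒¬multiplicityFree α (T₁.tableau H₁) (T₂.tableau H₂) T₁.rowOf T₂.rowOf (λ _ _ → refl) (λ _ _ → refl)
        (T₁.tableau-quasiYamanouchi H₁) (T₂.tableau-quasiYamanouchi H₂)
        (λ r → balance-cancel (keyRowCount α r) (T₁.rowCount-balance H₁ r) (T₂.rowCount-balance H₂ r)
                 (same-ends (𝟙 (r ≟ i)) (𝟙 (r ≟ j)) (𝟙 (r ≟ k)) (𝟙 (r ≟ l))))
        k xk k<ℓ (endsAt⇒< ek) differ
        where
        differ : T₁.rowOf k xk ≢ T₂.rowOf k xk
        differ e = <-irrefl rows (prev-k<j i k xk i<j ek)
          where
          rows : T₁.C₁.prev k ≡ j
          rows = trans (sym (T₁.rowOf-member₁ H₁ k xk (i<k , ≤-refl , ek) refl))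
                   (trans e (trans (T₂.rowOf-member₁ H₂ k xk (j<k , ≤-refl , ek) refl) (prev-k≡j k xk ek)))

    module Narrow (ak≡1+al : a k ≡ suc (a l))
                  (no123 : ∀ p q r → p < q → q < r → r < ℓ → a p < a q → a q < a r → ⊥) where
      w = a l
      ek′ : EndsAt w k
      ek′ = ak≡1+al
      xl<w : xl < w
      xl<w = endsAt⇒< el
      xl≢w : xl ≢ w
      xl≢w e = <-irrefl e xl<w
      w≥1 : 1 ≤ w
      w≥1 = ≤-trans xl≥1 (<⇒≤ xl<w)

      below-j : ∀ m → m < k → EndsAt w m → m < j
      below-j m m<k em with <-cmp m j
      ... | tri< m<j _ _ = m<j
      ... | tri≈ _ refl _ = ⊥-elim (gap-k′ j ≤-refl j<k (trans em (sym ek′)))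
      ... | tri> _ _ j<m = ⊥-elim (gap-k m j<m m<k (trans em (sym ek′)))

      module T₁ = TwoChains α j (EndsAt xl ∪ (_≡ k)) (endsAt? xl ∪? (_≟ k)) l xl i (EndsAt w) (endsAt? w) k w
      module T₂ = TwoChains α j (EndsAt w) (endsAt? w) k w i (EndsAt xl) (endsAt? xl) l xl

      H₁ : T₁.Hyps
      H₁ = record
        { positive = positive ; x₁≥1 = xl≥1 ; x₂≥1 = w≥1
        ; x₁<part = xl<part
        ; x₂<part = λ _ (_ , _ , e) → endsAt⇒< e
        ; top₁<ℓ = l<ℓ ; top₂<ℓ = k<ℓ
        ; top₁-node = inj₂ (j<l , ≤-refl , inj₁ el) ; top₂-node = inj₂ (i<k , ≤-refl , ek′)
        ; disjoint = λ e _ _ _ → xl≢w e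
        ; beyond₁ = beyond
        ; beyond₂ = λ _ _ (_ , _ , e) x<d d<a → ⊥-elim (endsAt-nothing-beyond e x<d d<a)
        ; descend₁₂ = descends
        ; descend₂₁ = λ _ _ _ w<xl → ⊥-elim (<-irrefl refl (<-trans w<xl xl<w))
        ; base₁-short = λ _ _ → ≤-pred (subst (a j <_) el aj<al)
        ; base₂-short = λ _ _ → <⇒≤ ai<al
        ; lastColumn₁ = λ _ _ _ _ _ e → inj₁ (inj₁ e)
        ; lastColumn₂ = λ _ _ _ _ _ e → inj₁ e
        ; adjacent₁₂ = adjacent
        ; adjacent₂₁ = λ _ _ _ _ e _ _ _ → ⊥-elim (<-irrefl e (<-trans xl<w (n<1+n w)))
        ; cross₁₂ = λ _ _ _ _ e _ → ⊥-elim (xl≢w (sym e))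
        ; cross₂₁ = λ _ _ _ _ e _ → ⊥-elim (xl≢w e)
        ; cross-distinct = λ _ _ _ _ e _ → xl≢w (sym e)
        }
        where
        xl<part : ∀ p → T₁.C₁.Member p → xl < a p
        xl<part p (_ , _ , inj₁ e)    = endsAt⇒< e
        xl<part p (_ , _ , inj₂ refl) = subst (xl <_) (sym ek′) (<-trans xl<w (n<1+n w))

        beyond : ∀ p d → T₁.C₁.Member p → xl < d → d < a p → T₁.C₂.Member p × d ≡ w
        beyond p d (_ , _ , inj₁ e)    xl<d d<a = ⊥-elim (endsAt-nothing-beyond e xl<d d<a)
        beyond p d (_ , _ , inj₂ refl) xl<d d<a =
          (i<k , ≤-refl , ek′) , ≤-antisym (≤-pred (subst (d <_) ek′ d<a)) (subst (_≤ d) (sym el) xl<d)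

        descends : ∀ p → T₁.C₁.Member p → T₁.C₂.Member p → xl < w → T₁.C₂.prev p ≤ T₁.C₁.prev p
        descends p (_ , _ , inj₁ e)    (_ , _ , e′) _ = ⊥-elim (xl≢w (endsAt-unique e e′))
        descends p (_ , _ , inj₂ refl) _           _ = <⇒≤ (<-≤-trans (prev-k<j i k w i<j ek′) (T₁.C₁.base≤prev k))

        adjacent : ∀ n m → T₁.C₁.Member n → T₁.C₂.Member m → w ≡ suc xl → m < n → T₁.C₁.prev n < m →
          ¬ T₁.C₁.Member m → T₁.C₁.prev n < T₁.C₂.prev m
        adjacent n m _ (i<m , m≤k , em) _ m<n prev<m ¬m₁ with m≤n⇒m<n∨m≡n m≤k
        ... | inj₂ refl = ⊥-elim (¬m₁ (j<k , <⇒≤ k<l , inj₂ refl))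
        ... | inj₁ m<k  = ⊥-elim (<-irrefl refl (<-trans prev<m (<-≤-trans (below-j m m<k em) (T₁.C₁.base≤prev n))))

      H₂ : T₂.Hyps
      H₂ = record
        { positive = positive ; x₁≥1 = w≥1 ; x₂≥1 = xl≥1
        ; x₁<part = λ _ (_ , _ , e) → endsAt⇒< e
        ; x₂<part = λ _ (_ , _ , e) → endsAt⇒< e
        ; top₁<ℓ = k<ℓ ; top₂<ℓ = l<ℓ
        ; top₁-node = inj₂ (j<k , ≤-refl , ek′) ; top₂-node = inj₂ (i<l , ≤-refl , el)
        ; disjoint = λ e _ _ _ → xl≢w (sym e)
        ; beyond₁ = λ _ _ (_ , _ , e) x<d d<a → ⊥-elim (endsAt-nothing-beyond e x<d d<a)
        ; beyond₂ = λ _ _ (_ , _ , e) x<d d<a → ⊥-elim (endsAt-nothing-beyond e x<d d<a)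
        ; descend₁₂ = λ _ (_ , _ , e) (_ , _ , e′) _ → ⊥-elim (xl≢w (endsAt-unique e′ e))
        ; descend₂₁ = λ _ (_ , _ , e) (_ , _ , e′) _ → ⊥-elim (xl≢w (endsAt-unique e′ e))
        ; base₁-short = λ _ _ → <⇒≤ aj<al
        ; base₂-short = λ _ _ → ≤-pred (subst (a i <_) el ai<al)
        ; lastColumn₁ = λ _ _ _ _ _ e → inj₁ e
        ; lastColumn₂ = λ _ _ _ _ _ e → inj₁ e
        ; adjacent₁₂ = λ _ _ _ _ e _ _ _ → ⊥-elim (<-irrefl e (<-trans xl<w (n<1+n w)))
        ; adjacent₂₁ = adjacent
        ; cross₁₂ = λ _ _ _ _ e _ → ⊥-elim (xl≢w e)
        ; cross₂₁ = λ _ _ _ _ e _ → ⊥-elim (xl≢w (sym e))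
        ; cross-distinct = λ _ _ _ _ e _ → xl≢w e
        }
        where
        adjacent : ∀ n m → T₂.C₂.Member n → T₂.C₁.Member m → w ≡ suc xl → m < n → T₂.C₂.prev n < m →
          ¬ T₂.C₂.Member m → T₂.C₂.prev n < T₂.C₁.prev m
        adjacent n m (i<n , n≤l , en) (j<m , m≤k , em) _ m<n prev<m _ with m≤n⇒m<n∨m≡n m≤k
        ... | inj₁ m<k  = ⊥-elim (gap-k m j<m m<k (trans em (sym ek′)))
        ... | inj₂ refl = subst (T₂.C₂.prev n <_) (sym (prev-k≡j l w ek′)) prev<j
          where
          -- A chain element strictly between j and k would give a pattern 1 2 3 with j and k.
          prev<j : T₂.C₂.prev n < j
          prev<j with T₂.C₂.prev-spec n
          ... | inj₁ e = subst (_< j) (sym e) i<j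
          ... | inj₂ (_ , eq) with <-cmp (T₂.C₂.prev n) j
          ...   | tri< lt _ _ = lt
          ...   | tri≈ _ refl _ = ⊥-elim (<-irrefl (trans eq (sym el)) aj<al)
          ...   | tri> _ _ gt = ⊥-elim (no123 j (T₂.C₂.prev n) k gt prev<m k<ℓ
                                   (subst (a j <_) (sym (trans eq (sym el))) aj<al)
                                   (subst (_< a k) (sym (trans eq (sym el))) al<ak))

      same-ends : ∀ I J K L → (L + K) + (J + I) ≡ (K + L) + (J + I)
      same-ends = solve-∀

      result : ¬ MultiplicityFree α
      result = twins⇒¬multiplicityFree α (T₁.tableau H₁) (T₂.tableau H₂) T₁.rowOf T₂.rowOf (λ _ _ → refl) (λ _ _ → refl)
        (T₁.tableau-quasiYamanouchi H₁) (T₂.tableau-quasiYamanouchi H₂)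
        (λ r → balance-cancel (keyRowCount α r) (T₁.rowCount-balance H₁ r) (T₂.rowCount-balance H₂ r)
                 (same-ends (𝟙 (r ≟ i)) (𝟙 (r ≟ j)) (𝟙 (r ≟ k)) (𝟙 (r ≟ l))))
        k w k<ℓ (endsAt⇒< ek′) differ
        where
        differ : T₁.rowOf k w ≢ T₂.rowOf k w
        differ e = <-irrefl rows (prev-k<j i k w i<j ek′)
          where
          rows : T₁.C₂.prev k ≡ j
          rows = trans (sym (T₁.rowOf-member₂ H₁ k w (i<k , ≤-refl , ek′) refl))
                   (trans e (trans (T₂.rowOf-member₁ H₂ k w (j<k , ≤-refl , ek′) refl) (prev-k≡j k w ek′)))

  least-after : ∀ j k → j < k →
    Σ ℕ λ k′ → j < k′ × k′ ≤ k × a k′ ≡ a k × (∀ m → j < m → m < k′ → a m ≢ a k′)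
  least-after j k j<k with leastWitness (λ m → (j <? m) ×-dec (a m ≟ a k)) k (k , ≤-refl , j<k , refl)
  ... | k′ , k′≤k , (j<k′ , ak′≡ak) , least =
    k′ , j<k′ , k′≤k , ak′≡ak , λ m j<m m<k′ e → least m m<k′ (j<m , trans e ak′≡ak)

  Increasing₃ : Set
  Increasing₃ = Σ ℕ λ r → r < ℓ × Σ ℕ λ q → q < r × Σ ℕ λ p → p < q × a p < a q × a q < a r

  increasing₃? : Dec Increasing₃
  increasing₃? = anyUpTo? (λ r → anyUpTo? (λ q → anyUpTo? (λ p → (a p <? a q) ×-dec (a q <? a r)) q) r) ℓ

  case₁ : ∀ i j k → i < j → j < k → k < ℓ → a i < a j → a j < a k → ¬ MultiplicityFree α
  case₁ = Case₁.result

  case₂ : ∀ i j k l → i < j → j < k → k < l → l < ℓ → a i < a l → a j < a l → a l < a k → ¬ MultiplicityFree α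
  case₂ i j k l i<j j<k k<l l<ℓ ai<al aj<al al<ak with least-after j k j<k
  ... | k′ , j<k′ , k′≤k , ak′≡ak , gap
    with m≤n⇒m<n∨m≡n (subst (a l <_) (sym ak′≡ak) al<ak)
  ...   | inj₁ 1+al<ak′ =
    Case₂.Wide.result i j k′ l i<j j<k′ (≤-<-trans k′≤k k<l) l<ℓ ai<al aj<al (<-trans (n<1+n (a l)) 1+al<ak′) gap 1+al<ak′
  ...   | inj₂ 1+al≡ak′ with increasing₃?
  ...     | yes (r , r<ℓ , q , q<r , p , p<q , ap<aq , aq<ar) = case₁ p q r p<q q<r r<ℓ ap<aq aq<ar
  ...     | no ¬increasing₃ =
    Case₂.Narrow.result i j k′ l i<j j<k′ (≤-<-trans k′≤k k<l) l<ℓ ai<al aj<al (subst (a l <_) 1+al≡ak′ ≤-refl) gap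
      (sym 1+al≡ak′)
      (λ p q r p<q q<r r<ℓ ap<aq aq<ar → ¬increasing₃ (r , r<ℓ , q , q<r , p , p<q , ap<aq , aq<ar))

  case₃ : ∀ i j k l → i < j → j < k → k < l → l < ℓ → a i < a k → suc (a j) < a k → a k ≡ a l → ¬ MultiplicityFree α
  case₃ i j k l i<j j<k k<l l<ℓ ai<ak 1+aj<ak ak≡al with least-after j k j<k
  ... | k′ , j<k′ , k′≤k , ak′≡ak , gap-k with least-after k′ l (≤-<-trans k′≤k k<l)
  ...   | l′ , k′<l′ , l′≤l , al′≡al , gap-l =
    Case₃.result i j k′ l′ i<j j<k′ k′<l′ (≤-<-trans l′≤l l<ℓ)
      (subst (a i <_) (sym ak′≡ak) ai<ak) (subst (suc (a j) <_) (sym ak′≡ak) 1+aj<ak)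
      (trans al′≡al (trans (sym ak≡al) (sym ak′≡ak)))
      gap-k (λ m k′<m m<l′ e → gap-l m k′<m m<l′ (trans e (trans ak′≡ak (trans ak≡al (sym al′≡al)))))

theorem4p1 : (α : List ℕ) → StrongComposition α →
    ((Σ[ i ∈ Fin (length α) ] Σ[ j ∈ Fin (length α) ] Σ[ k ∈ Fin (length α) ]
        (toℕ i < toℕ j × toℕ j < toℕ k
         × lookup α i < lookup α j × lookup α j < lookup α k))
      → ¬ MultiplicityFree α)
    × ((Σ[ i ∈ Fin (length α) ] Σ[ j ∈ Fin (length α) ] Σ[ k ∈ Fin (length α) ] Σ[ l ∈ Fin (length α) ]
        (toℕ i < toℕ j × toℕ j < toℕ k × toℕ k < toℕ l
         × lookup α i < lookup α l × lookup α j < lookup α l × lookup α l < lookup α k))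
      → ¬ MultiplicityFree α)
    × ((Σ[ i ∈ Fin (length α) ] Σ[ j ∈ Fin (length α) ] Σ[ k ∈ Fin (length α) ] Σ[ l ∈ Fin (length α) ]
        (toℕ i < toℕ j × toℕ j < toℕ k × toℕ k < toℕ l
         × lookup α i < lookup α k × lookup α j + 1 < lookup α k × lookup α k ≡ lookup α l))
      → ¬ MultiplicityFree α)
theorem4p1 α strong =
  (λ (i , j , k , i<j , j<k , ai<aj , aj<ak) →
     case₁ (toℕ i) (toℕ j) (toℕ k) i<j j<k (toℕ<n k) (parts< i j ai<aj) (parts< j k aj<ak)) ,
  (λ (i , j , k , l , i<j , j<k , k<l , ai<al , aj<al , al<ak) →
     case₂ (toℕ i) (toℕ j) (toℕ k) (toℕ l) i<j j<k k<l (toℕ<n l) (parts< i l ai<al) (parts< j l aj<al) (parts< l k al<ak)) ,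
  (λ (i , j , k , l , i<j , j<k , k<l , ai<ak , aj+1<ak , ak≡al) →
     case₃ (toℕ i) (toℕ j) (toℕ k) (toℕ l) i<j j<k k<l (toℕ<n l) (parts< i k ai<ak)
       (subst₂ _<_ (trans (+-comm (lookup α j) 1) (cong suc (lookup≡partAt α j))) (lookup≡partAt α k) aj+1<ak)
       (trans (sym (lookup≡partAt α k)) (trans ak≡al (lookup≡partAt α l))))
  where
  open Patterns α strong
  parts< : ∀ i j → lookup α i < lookup α j → a (toℕ i) < a (toℕ j)
  parts< i j = subst₂ _<_ (lookup≡partAt α i) (lookup≡partAt α j)
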